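{- Let $P$ be an $n$-element poset with connected components $P_1,\dots,P_r$. Let $n_i=|P_i|$ and let $t_i$ denote the number of tangled labelings of $P_i$. A labeling $L$ of $P$ is tangled if and only if there is some $i\in[r]$ such that $\operatorname{st}(L|_{P_i})$ is a tangled labeling of $P_i$ and $L^{ -1}(n-1),L^{ -1}(n)\in P_i$. Consequently (for $n\ge 2$), the number of tangled labelings of $P$ is \[(n-2)!\sum_{i=1}^r\frac{t_i}{(n_i-2)!},\] where terms with $n_i=1$ (for which $t_i=0$) are taken to be $0$.
   Context: A labeling of a finite $n$-element poset $P$ is a bijection $L:P\to[n]$; a linear extension is a labeling with $L(x)\le L(y)$ whenever $x\le_P y$. The connected components of $P$ are the subposets formed by the connected components of its Hasse diagram. For a subset $S\subseteq P$ with $|S|=s$ and an injective $f:S\to\mathbb Z$, the standardization $\operatorname{st}(f)$ is the unique bijection $S\to[s]$ with $\operatorname{st}(f)(x)<\operatorname{st}(f)(y)$ iff $f(x)<f(y)$. For a labeling $L$ and a non-maximal $x\in P$, the $L$-successor of $x$ is the element $y>_P x$ minimizing $L(y)$. The promotion chain of $L$ is $v_1<_P\cdots<_P v_m$, where $v_1=L^{ -1}(1)$, $v_{i+1}$ is the $L$-successor of $v_i$ as long as $v_i$ is not maximal, and $v_m$ is maximal. Extended promotion is defined by $\partial(L)(x)=L(x)-1$ if $x$ is not in the promotion chain, $\partial(L)(v_i)=L(v_{i+1})-1$ for $1\le i\le m-1$, and $\partial(L)(v_m)=n$. A labeling $L$ of an $n$-element poset is tangled if $n\ge 2$ and $\partial^{n-2}(L)$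 is not a linear extension (so the unique labeling of a $1$-element poset is not tangled). -}

module Defs where

open import Level using (0ℓ)
open import Data.Bool using (Bool; true; false; if_then_else_)
open import Data.Nat as ℕ using (ℕ; zero; suc; _∸_; _!)
open import Data.Nat.Properties using (_!≢0)
open import Data.Fin as Fin using (Fin; zero; suc; toℕ)
open import Data.Fin.Properties using (all?; any?)
open import Data.Fin.Subset using (Subset; ∣_∣; _∈_; inside; outside)
open import Data.Vec using (Vec; []; _∷_; lookup)
open import Data.List as List using (List; []; _∷_; allFin; filter; length; upTo)
open import Data.Maybe using (Maybe; just; nothing)
open import Data.Product using (Σ; ∃; _×_; _,_)
open import Data.Sum using (_⊎_)
open import Data.Empty using (⊥)
open import Data.Integer using (+_)
open import Data.Rational as ℚ using (ℚ; 0ℚ)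
open import Relation.Binary using (Rel; Decidable)
open import Relation.Binary.PropositionalEquality using (_≡_; _≢_)
open import Relation.Binary.Construct.Closure.ReflexiveTransitive using (Star)
open import Relation.Nullary using (Dec; yes; no; ¬_; does; ¬?)
open import Relation.Nullary.Decidable using (_×-dec_; _→-dec_)
open import Function.Bundles using (_⇔_)

-- The partial-order axioms are assumed separately
-- (as a hypothesis of the theorem) so that induced sub-relations can be
-- formed without carrying proofs.

record FinRel (n : ℕ) : Set₁ where
  field
    _≤P_ : Rel (Fin n) 0ℓ
    _≤P?_ : Decidable _≤P_

  _<P_ : Rel (Fin n) 0ℓ
  x <P y = x ≤P y × x ≢ y

  _<P?_ : Decidable _<P_
  x <P? y = (x ≤P? y) ×-dec ¬? (x Fin.≟ y)

open FinRel public

IsLabeling : (n : ℕ) → (Fin n → ℕ) → Set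
IsLabeling n L =
    (∀ x → 1 ℕ.≤ L x × L x ℕ.≤ n)
  × (∀ x y → L x ≡ L y → x ≡ y)
  × (∀ (k : Fin n) → ∃ λ x → L x ≡ suc (toℕ k))

isLabeling? : (n : ℕ) (L : Fin n → ℕ) → Dec (IsLabeling n L)
isLabeling? n L =
      all? (λ x → (1 ℕ.≤? L x) ×-dec (L x ℕ.≤? n))
  ×-dec all? (λ x → all? (λ y → (L x ℕ.≟ L y) →-dec (x Fin.≟ y)))
  ×-dec all? (λ k → any? (λ x → L x ℕ.≟ suc (toℕ k)))

IsLinExt : ∀ {n} → FinRel n → (Fin n → ℕ) → Set
IsLinExt P L = ∀ x y → _≤P_ P x y → L x ℕ.≤ L y

isLinExt? : ∀ {n} (P : FinRel n) (L : Fin n → ℕ) → Dec (IsLinExt P L)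
isLinExt? P L = all? (λ x → all? (λ y → _≤P?_ P x y →-dec (L x ℕ.≤? L y)))

findFirst : ∀ {n} {Q : Fin n → Set} → ((x : Fin n) → Dec (Q x)) → Maybe (Fin n)
findFirst {zero} Q? = nothing
findFirst {suc n} Q? with does (Q? zero)
... | true = just zero
... | false with findFirst {n} (λ x → Q? (suc x))
...   | just x = just (suc x)
...   | nothing = nothing

minBy : ∀ {n} → (Fin n → ℕ) → List (Fin n) → Maybe (Fin n)
minBy L [] = nothing
minBy L (x ∷ xs) with minBy L xs
... | nothing = just x
... | just y = if does (L x ℕ.≤? L y) then just x else just y

successor : ∀ {n} → FinRel n → (Fin n → ℕ) → Fin n → Maybe (Fin n)
successor P L x = minBy L (filter (λ y → _<P?_ P x y) (allFin _))

-- the chain v, succ v, succ succ v, … (with fuel; fuel n suffices for a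
-- poset on n elements since the chain is strictly increasing)
chainFrom : ∀ {n} → FinRel n → (Fin n → ℕ) → ℕ → Fin n → List (Fin n)
chainFrom P L zero v = v ∷ []
chainFrom P L (suc k) v with successor P L v
... | nothing = v ∷ []
... | just w = v ∷ chainFrom P L k w

promotionChain : ∀ {n} → FinRel n → (Fin n → ℕ) → List (Fin n)
promotionChain {n} P L with findFirst (λ x → L x ℕ.≟ 1)
... | nothing = []
... | just v₁ = chainFrom P L n v₁

∂at : ∀ {n} → (Fin n → ℕ) → List (Fin n) → Fin n → ℕ
∂at {n} L [] x = L x ∸ 1
∂at {n} L (v ∷ []) x = if does (x Fin.≟ v) then n else L x ∸ 1
∂at {n} L (v ∷ w ∷ vs) x =
  if does (x Fin.≟ v) then L w ∸ 1 else ∂at L (w ∷ vs) x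

∂ : ∀ {n} → FinRel n → (Fin n → ℕ) → (Fin n → ℕ)
∂ P L = ∂at L (promotionChain P L)

iter : ∀ {A : Set} → ℕ → (A → A) → A → A
iter zero f a = a
iter (suc k) f a = f (iter k f a)

Tangled : ∀ {n} → FinRel n → (Fin n → ℕ) → Set
Tangled {n} P L = 2 ℕ.≤ n × ¬ IsLinExt P (iter (n ∸ 2) (∂ P) L)

tangled? : ∀ {n} (P : FinRel n) (L : Fin n → ℕ) → Dec (Tangled P L)
tangled? {n} P L = (2 ℕ.≤? n) ×-dec ¬? (isLinExt? P (iter (n ∸ 2) (∂ P) L))

-- Counting labelings: every function Fin n → [n] is represented by
-- exactly one vector in allVecs.

allVecs : ∀ {A : Set} → List A → (m : ℕ) → List (Vec A m)
allVecs xs zero = [] ∷ []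
allVecs xs (suc m) =
  List.concatMap (λ a → List.map (a ∷_) (allVecs xs m)) xs

range1 : ℕ → List ℕ
range1 n = List.map suc (upTo n)

numTangled : ∀ {n} → FinRel n → ℕ
numTangled {n} P =
  length (filter (λ v → isLabeling? n (lookup v) ×-dec tangled? P (lookup v))
                 (allVecs (range1 n) n))

emb : ∀ {n} (S : Subset n) → Fin ∣ S ∣ → Fin n
emb (inside ∷ S) zero = zero
emb (inside ∷ S) (suc i) = suc (emb S i)
emb (outside ∷ S) i = suc (emb S i)

induced : ∀ {n} → FinRel n → (S : Subset n) → FinRel ∣ S ∣
induced P S = record
  { _≤P_ = λ i j → _≤P_ P (emb S i) (emb S j)
  ; _≤P?_ = λ i j → _≤P?_ P (emb S i) (emb S j) }

-- standardization st(L|_S) : S → [|S|], as a labeling of induced P S: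
-- the element with the k-th smallest L-value gets label k.
st : ∀ {n} → (Fin n → ℕ) → (S : Subset n) → Fin ∣ S ∣ → ℕ
st L S i =
  suc (length (filter (λ j → L (emb S j) ℕ.<? L (emb S i)) (allFin _)))

Covers : ∀ {n} → FinRel n → Rel (Fin n) 0ℓ
Covers P x y = _<P_ P x y × (∀ z → _<P_ P x z → _<P_ P z y → ⊥)

HasseEdge : ∀ {n} → FinRel n → Rel (Fin n) 0ℓ
HasseEdge P x y = Covers P x y ⊎ Covers P y x

Connected : ∀ {n} → FinRel n → Rel (Fin n) 0ℓ
Connected P = Star (HasseEdge P)

IsComponent : ∀ {n} → FinRel n → Subset n → Set
IsComponent P S = (∃ λ x → x ∈ S) × (∀ x y → x ∈ S → (y ∈ S ⇔ Connected P x y))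

AreComponents : ∀ {n} → FinRel n → (r : ℕ) → (Fin r → Subset n) → Set
AreComponents P r C =
    (∀ i → IsComponent P (C i))
  × (∀ i j → C i ≡ C j → i ≡ j)
  × (∀ x → ∃ λ i → x ∈ C i)

∑ : (r : ℕ) → (Fin r → ℚ) → ℚ
∑ zero f = 0ℚ
∑ (suc r) f = f zero ℚ.+ ∑ r (λ i → f (suc i))

ℕ→ℚ : ℕ → ℚ
ℕ→ℚ m = + m ℚ./ 1

_/!_ : ℕ → ℕ → ℚ
t /! d = ((+ t) ℚ./ (d !)) {{d !≢0}}

module Submission where

-- Extended promotion moves labels only along the promotion chain, which starts at the
-- element labeled 1 and stays inside its connected component. Hence, after
-- standardization on a component C, one promotion of P acts as one promotion of C when
-- label 1 lies in C and as the identity otherwise, so after k promotions C has been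
-- promoted once for each of its elements with label at most k. After k promotions every
-- element with a label above n - k carries a smaller label than all elements above it,
-- so ∂ⁿ⁻¹ sorts every labeling into a linear extension.
-- Consequently ∂ⁿ⁻² L can fail to be a linear extension only on a component containing
-- both labels n - 1 and n, and it does so there exactly when the standardization of L on
-- that component is tangled.
--
-- For the count, the labelings of P with both top labels in C fibre over the labelings
-- of C via standardization. Relabeling C transports one fibre onto another, so all
-- fibres have a common size F, and counting all labelings with both top labels in C
-- gives |C|! F = |C| (|C| - 1) (n - 2)!.

open import Defs
open import Data.Nat using (ℕ; _≤_; _∸_; _!)
open import Data.Fin using (Fin)
open import Data.Fin.Subset using (Subset; ∣_∣; _∈_)
open import Data.Product using (∃; _×_; _,_)
open import Relation.Binary.PropositionalEquality using (_≡_; trans; cong)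
open import Relation.Binary.Structures using (IsPartialOrder)
open import Function using (_∘_)
open import Function.Bundles using (_⇔_)

-- A separate module keeps ℕ's _*_ apart from the rational _*_ of the statement.

module ExtendedPromotion where

  open import Data.Bool using (true; false; T; if_then_else_)
  open import Data.Empty using (⊥; ⊥-elim)
  open import Data.Fin as Fin using (Fin; zero; suc; toℕ; fromℕ<; punchOut)
  open import Data.Fin.Properties as Finₚ using (toℕ<n; toℕ-fromℕ<; fromℕ<-injective; punchOut-injective; injective⇒≤)
  open import Data.Fin.Subset using (Subset; ∣_∣; _∈_; _∉_; inside; outside)
  open import Data.Fin.Subset.Properties using (_∈?_; ∣p∣≤n; ⊆-antisym)
  import Data.Integer as ℤ
  import Data.Integer.Properties as ℤₚ
  open import Data.List as List using (List; []; _∷_; [_]; length; filter; map; concatMap; _++_; allFin; upTo)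
  import Data.List.Properties as Listₚ
  open import Data.List.Membership.Propositional using () renaming (_∈_ to _∈ₗ_; _∉_ to _∉ₗ_)
  open import Data.List.Membership.Propositional.Properties
    using (∈-filter⁺; ∈-filter⁻; ∈-allFin; ∈-map⁺; ∈-map⁻; ∈-upTo⁺; ∈-upTo⁻)
  open import Data.List.Relation.Unary.All as All using (All; []; _∷_)
  open import Data.List.Relation.Unary.AllPairs using (AllPairs; []; _∷_)
  import Data.List.Relation.Unary.AllPairs.Properties as AllPairsₚ
  open import Data.List.Relation.Unary.Any as Any using (here; there)
  import Data.List.Relation.Unary.Unique.Propositional.Properties as Uniqueₚ
  open import Data.Maybe using (just; nothing)
  open import Data.Nat as ℕ using (ℕ; zero; suc; _+_; _*_; _∸_; _≤_; _<_; z≤n; s≤s; _≤?_; _<?_; _!)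
  open import Data.Nat.Properties
  open import Data.Product using (∃; _×_; _,_; proj₁; proj₂)
  open import Data.Rational as ℚ using (ℚ; toℚᵘ)
  import Data.Rational.Properties as ℚₚ
  open import Data.Rational.Unnormalised as ℚᵘ using (mkℚᵘ; *≡*)
  import Data.Rational.Unnormalised.Properties as ℚᵘₚ
  open import Data.Sum using (_⊎_; inj₁; inj₂)
  open import Data.Unit using (⊤; tt)
  open import Data.Vec as Vec using (Vec; []; _∷_; lookup; tabulate)
  open import Data.Vec.Properties using (lookup∘tabulate; tabulate∘lookup)
  import Data.Vec.Relation.Unary.All as VAll
  open import Data.Vec.Relation.Unary.All.Properties using (lookup⁺)
  open import Data.Vec.Relation.Unary.AllPairs as VAllPairs using ([]; _∷_)
  open import Data.Vec.Relation.Unary.Unique.Propositional using (Unique)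
  import Data.Vec.Relation.Unary.Unique.Propositional.Properties as VUniqueₚ
  open import Relation.Nullary using (Dec; yes; no; ¬_; ¬?; does; contradiction)
  open import Relation.Nullary.Decidable using (_×-dec_)
  open import Relation.Binary.PropositionalEquality
    using (_≡_; _≢_; refl; sym; trans; cong; cong₂; subst; subst₂; module ≡-Reasoning)
  open import Relation.Binary.PropositionalEquality.Properties using (isEquivalence)
  open import Relation.Binary.Construct.Closure.ReflexiveTransitive using (ε; _◅_; _◅◅_; reverse)
  open import Relation.Binary.Structures using (IsPartialOrder)
  open import Function using (_∘_)
  open import Function.Bundles using (_⇔_; mk⇔; Equivalence)
  open import Algebra.Properties.CommutativeSemigroup +-commutativeSemigroup
    using () renaming (x∙yz≈y∙xz to x+[y+z]≡y+[x+z])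
  open import Algebra.Properties.CommutativeSemigroup *-commutativeSemigroup
    using () renaming (x∙yz≈y∙xz to x*[y*z]≡y*[x*z])
  open import Data.List.Membership.DecPropositional ℕ._≟_ using () renaming (_∈?_ to _∈ₗ?_)

  suc-∸1 : ∀ {a} → 1 ≤ a → suc (a ∸ 1) ≡ a
  suc-∸1 (s≤s _) = refl

  ∸1-injective : ∀ {a b} → 1 ≤ a → 1 ≤ b → a ∸ 1 ≡ b ∸ 1 → a ≡ b
  ∸1-injective (s≤s _) (s≤s _) = cong suc

  ∸1-mono-< : ∀ {a b} → 1 ≤ a → a < b → a ∸ 1 < b ∸ 1
  ∸1-mono-< (s≤s _) (s≤s a<b) = a<b

  ∸1-cancel-< : ∀ {a b} → 1 ≤ a → a ∸ 1 < b ∸ 1 → a < b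
  ∸1-cancel-< {b = suc b} (s≤s _) a<b = s≤s a<b

  ∸1<bound : ∀ {a k} → 1 ≤ a → a ≤ k → a ∸ 1 < k
  ∸1<bound (s≤s _) a≤k = a≤k

  count : ∀ m {Q : Fin m → Set} → ((i : Fin m) → Dec (Q i)) → ℕ
  count zero Q? = 0
  count (suc m) Q? with Q? zero
  ... | yes _ = suc (count m (Q? ∘ suc))
  ... | no _ = count m (Q? ∘ suc)

  length-filter-tabulate : ∀ {A : Set} m (f : Fin m → A) {P : A → Set} (P? : (a : A) → Dec (P a)) →
    length (filter P? (List.tabulate f)) ≡ count m (P? ∘ f)
  length-filter-tabulate zero f P? = refl
  length-filter-tabulate (suc m) f P? with P? (f zero)
  ... | yes _ = cong suc (length-filter-tabulate m (f ∘ suc) P?)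
  ... | no _ = length-filter-tabulate m (f ∘ suc) P?

  count-mono : ∀ {m} {Q R : Fin m → Set} (Q? : ∀ i → Dec (Q i)) (R? : ∀ i → Dec (R i)) →
    (∀ i → Q i → R i) → count m Q? ≤ count m R?
  count-mono {zero} Q? R? Q⇒R = z≤n
  count-mono {suc m} Q? R? Q⇒R with Q? zero | R? zero
  ... | yes _ | yes _ = s≤s (count-mono (Q? ∘ suc) (R? ∘ suc) (Q⇒R ∘ suc))
  ... | yes q | no ¬r = contradiction (Q⇒R zero q) ¬r
  ... | no _  | yes _ = m≤n⇒m≤1+n (count-mono (Q? ∘ suc) (R? ∘ suc) (Q⇒R ∘ suc))
  ... | no _  | no _ = count-mono (Q? ∘ suc) (R? ∘ suc) (Q⇒R ∘ suc)

  count-mono-< : ∀ {m} {Q R : Fin m → Set} (Q? : ∀ i → Dec (Q i)) (R? : ∀ i → Dec (R i)) →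
    (∀ i → Q i → R i) → (k : Fin m) → R k → ¬ Q k → count m Q? < count m R?
  count-mono-< {suc m} Q? R? Q⇒R k rk ¬qk with Q? zero | R? zero | k
  ... | yes q | _     | zero = contradiction q ¬qk
  ... | no _  | no ¬r | zero = contradiction rk ¬r
  ... | no _  | yes _ | zero = s≤s (count-mono (Q? ∘ suc) (R? ∘ suc) (Q⇒R ∘ suc))
  ... | yes q | no ¬r | suc _ = contradiction (Q⇒R zero q) ¬r
  ... | yes _ | yes _ | suc k = s≤s (count-mono-< (Q? ∘ suc) (R? ∘ suc) (Q⇒R ∘ suc) k rk ¬qk)
  ... | no _  | yes _ | suc k = m≤n⇒m≤1+n (count-mono-< (Q? ∘ suc) (R? ∘ suc) (Q⇒R ∘ suc) k rk ¬qk)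
  ... | no _  | no _  | suc k = count-mono-< (Q? ∘ suc) (R? ∘ suc) (Q⇒R ∘ suc) k rk ¬qk

  count-cong : ∀ {m} {Q R : Fin m → Set} (Q? : ∀ i → Dec (Q i)) (R? : ∀ i → Dec (R i)) →
    (∀ i → Q i → R i) → (∀ i → R i → Q i) → count m Q? ≡ count m R?
  count-cong Q? R? Q⇒R R⇒Q = ≤-antisym (count-mono Q? R? Q⇒R) (count-mono R? Q? R⇒Q)

  count-split : ∀ {m} {Q : Fin m → Set} (Q? : ∀ i → Dec (Q i)) {R : Fin m → Set} (R? : ∀ i → Dec (R i)) →
    count m Q? ≡ count m (λ i → Q? i ×-dec R? i) + count m (λ i → Q? i ×-dec ¬? (R? i))
  count-split {zero} Q? R? = refl
  count-split {suc m} Q? R? with Q? zero | R? zero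
  ... | yes _ | yes _ = cong suc (count-split (Q? ∘ suc) (R? ∘ suc))
  ... | yes _ | no _ = trans (cong suc (count-split (Q? ∘ suc) (R? ∘ suc))) (sym (+-suc _ _))
  ... | no _  | yes _ = count-split (Q? ∘ suc) (R? ∘ suc)
  ... | no _  | no _ = count-split (Q? ∘ suc) (R? ∘ suc)

  count≤ : ∀ {m} {Q : Fin m → Set} (Q? : ∀ i → Dec (Q i)) → count m Q? ≤ m
  count≤ {zero} Q? = z≤n
  count≤ {suc m} Q? with Q? zero
  ... | yes _ = s≤s (count≤ (Q? ∘ suc))
  ... | no _ = m≤n⇒m≤1+n (count≤ (Q? ∘ suc))

  count-all : ∀ {m} {Q : Fin m → Set} (Q? : ∀ i → Dec (Q i)) → (∀ i → Q i) → count m Q? ≡ m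
  count-all {zero} Q? all = refl
  count-all {suc m} Q? all with Q? zero
  ... | yes _ = cong suc (count-all (Q? ∘ suc) (all ∘ suc))
  ... | no ¬q = contradiction (all zero) ¬q

  count-none : ∀ {m} {Q : Fin m → Set} (Q? : ∀ i → Dec (Q i)) → (∀ i → ¬ Q i) → count m Q? ≡ 0
  count-none {zero} Q? none = refl
  count-none {suc m} Q? none with Q? zero
  ... | yes q = contradiction q (none zero)
  ... | no _ = count-none (Q? ∘ suc) (none ∘ suc)

  count-pos : ∀ {m} {Q : Fin m → Set} (Q? : ∀ i → Dec (Q i)) (k : Fin m) → Q k → 1 ≤ count m Q?
  count-pos Q? k qk =
    subst (_< count _ Q?) (count-none never (λ _ ())) (count-mono-< never Q? (λ _ ()) k qk λ ())
    where
    never : ∀ i → Dec ⊥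
    never _ = no λ ()

  count-≡ : ∀ {m} (k : Fin m) → count m (Fin._≟ k) ≡ 1
  count-≡ {suc m} zero = cong suc (count-none {m} (λ i → suc i Fin.≟ zero) λ _ ())
  count-≡ {suc m} (suc k) =
    trans (count-cong (λ i → suc i Fin.≟ suc k) (Fin._≟ k) (λ _ → Finₚ.suc-injective) (λ _ → cong suc))
          (count-≡ k)

  count-unique : ∀ {m} {Q : Fin m → Set} (Q? : ∀ i → Dec (Q i)) (k : Fin m) → Q k →
    (∀ i → Q i → i ≡ k) → count m Q? ≡ 1
  count-unique Q? k qk unique =
    trans (count-cong Q? (Fin._≟ k) unique (λ { _ refl → qk })) (count-≡ k)

  module _ {m} {L : Fin m → ℕ} (lab : IsLabeling m L) where

    label-pos : ∀ x → 1 ≤ L x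
    label-pos x = proj₁ (proj₁ lab x)

    label≤ : ∀ x → L x ≤ m
    label≤ x = proj₂ (proj₁ lab x)

    label-injective : ∀ x y → L x ≡ L y → x ≡ y
    label-injective = proj₁ (proj₂ lab)

    element-labeled : ∀ t → 1 ≤ t → t ≤ m → ∃ λ x → L x ≡ t
    element-labeled (suc t) _ t<m with proj₂ (proj₂ lab) (fromℕ< t<m)
    ... | x , Lx≡ = x , trans Lx≡ (cong suc (toℕ-fromℕ< t<m))

    count-labels≤ : ∀ t → t ≤ m → count m (λ x → L x ≤? t) ≡ t
    count-labels≤ zero _ = count-none _ (λ x Lx≤0 → 1+n≰n (≤-trans (label-pos x) Lx≤0))
    count-labels≤ (suc t) t<m = begin
      count m (λ x → L x ≤? suc t)
        ≡⟨ count-split (λ x → L x ≤? suc t) (λ x → L x ≤? t) ⟩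
      count m (λ x → (L x ≤? suc t) ×-dec (L x ≤? t))
        + count m (λ x → (L x ≤? suc t) ×-dec ¬? (L x ≤? t))
        ≡⟨ cong₂ _+_ (trans (count-cong _ (λ x → L x ≤? t) (λ _ → proj₂) (λ _ p → m≤n⇒m≤1+n p , p))
                            (count-labels≤ t (<⇒≤ t<m)))
                     (count-unique _ y (≤-reflexive Ly≡ , (λ Ly≤t → 1+n≰n (subst (_≤ t) Ly≡ Ly≤t)))
                        λ x (p , q) → label-injective x y (trans (≤-antisym p (≰⇒> q)) (sym Ly≡))) ⟩
      t + 1
        ≡⟨ +-comm t 1 ⟩
      suc t ∎
      where
      open ≡-Reasoning
      y = proj₁ (element-labeled (suc t) (s≤s z≤n) t<m)
      Ly≡ = proj₂ (element-labeled (suc t) (s≤s z≤n) t<m)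

    label≡suc-count-smaller : ∀ x → L x ≡ suc (count m (λ y → L y <? L x))
    label≡suc-count-smaller x = begin
      L x
        ≡⟨ suc-∸1 (label-pos x) ⟨
      suc (L x ∸ 1)
        ≡⟨ cong suc (count-labels≤ (L x ∸ 1) (≤-trans (m∸n≤m (L x) 1) (label≤ x))) ⟨
      suc (count m (λ y → L y ≤? L x ∸ 1))
        ≡⟨ cong suc (count-cong (λ y → L y ≤? L x ∸ 1) (λ y → L y <? L x) (λ _ → smaller) (λ _ → <⇒≤pred)) ⟩
      suc (count m (λ y → L y <? L x)) ∎
      where
      open ≡-Reasoning
      smaller : ∀ {a} → a ≤ L x ∸ 1 → a < L x
      smaller a≤ = subst (_ ≤_) (suc-∸1 (label-pos x)) (s≤s a≤)

  labeling-cong : ∀ {m} {L L′ : Fin m → ℕ} → (∀ x → L x ≡ L′ x) → IsLabeling m L → IsLabeling m L′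
  labeling-cong {m} L≗L′ (bounds , injective , surjective) =
      (λ x → subst (λ t → 1 ≤ t × t ≤ m) (L≗L′ x) (bounds x))
    , (λ x y e → injective x y (trans (L≗L′ x) (trans e (sym (L≗L′ y)))))
    , (λ k → proj₁ (surjective k) , trans (sym (L≗L′ _)) (proj₂ (surjective k)))

  -- Punching out a missed value would inject Fin m into Fin (m - 1).
  injective⇒surjective : ∀ {m} (f : Fin m → Fin m) → (∀ {x y} → f x ≡ f y → x ≡ y) →
    ∀ k → ∃ λ x → f x ≡ k
  injective⇒surjective {suc m} f f-injective k with Finₚ.any? (λ x → f x Fin.≟ k)
  ... | yes hit = hit
  ... | no missed = contradiction (injective⇒≤ squeeze-injective) 1+n≰n
    where
    k≢f : ∀ x → k ≢ f x
    k≢f x k≡fx = missed (x , sym k≡fx)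
    squeeze : Fin (suc m) → Fin m
    squeeze x = punchOut (k≢f x)
    squeeze-injective : ∀ {x y} → squeeze x ≡ squeeze y → x ≡ y
    squeeze-injective {x} {y} = f-injective ∘ punchOut-injective (k≢f x) (k≢f y)

  injective⇒labeling : ∀ {m} (L : Fin m → ℕ) → (∀ x → 1 ≤ L x × L x ≤ m) →
    (∀ x y → L x ≡ L y → x ≡ y) → IsLabeling m L
  injective⇒labeling {m} L bounds injective = bounds , injective , surjective
    where
    index : Fin m → Fin m
    index x = fromℕ< (∸1<bound (proj₁ (bounds x)) (proj₂ (bounds x)))

    index-injective : ∀ {x y} → index x ≡ index y → x ≡ y
    index-injective {x} {y} e = injective x y (∸1-injective (proj₁ (bounds x)) (proj₁ (bounds y))
      (fromℕ<-injective _ _ _ _ e))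

    surjective : ∀ (k : Fin m) → ∃ λ x → L x ≡ suc (toℕ k)
    surjective k with injective⇒surjective index index-injective k
    ... | x , refl = x , sym (trans (cong suc (toℕ-fromℕ< _)) (suc-∸1 (proj₁ (bounds x))))

  emb-∈ : ∀ {n} (S : Subset n) i → emb S i ∈ S
  emb-∈ (inside ∷ S) zero = Vec.here
  emb-∈ (inside ∷ S) (suc i) = Vec.there (emb-∈ S i)
  emb-∈ (outside ∷ S) i = Vec.there (emb-∈ S i)

  emb-injective : ∀ {n} (S : Subset n) i j → emb S i ≡ emb S j → i ≡ j
  emb-injective (inside ∷ S) zero zero _ = refl
  emb-injective (inside ∷ S) (suc i) (suc j) e = cong suc (emb-injective S i j (Finₚ.suc-injective e))
  emb-injective (outside ∷ S) i j e = emb-injective S i j (Finₚ.suc-injective e)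

  emb-surjective : ∀ {n} (S : Subset n) x → x ∈ S → ∃ λ i → emb S i ≡ x
  emb-surjective (inside ∷ S) zero Vec.here = zero , refl
  emb-surjective (inside ∷ S) (suc x) (Vec.there x∈S) with emb-surjective S x x∈S
  ... | i , refl = suc i , refl
  emb-surjective (outside ∷ S) (suc x) (Vec.there x∈S) with emb-surjective S x x∈S
  ... | i , refl = i , refl

  induced-isPartialOrder : ∀ {n} (P : FinRel n) → IsPartialOrder _≡_ (_≤P_ P) → (S : Subset n) →
    IsPartialOrder _≡_ (_≤P_ (induced P S))
  induced-isPartialOrder P po S = record
    { isPreorder = record
      { isEquivalence = isEquivalence
      ; reflexive = λ { refl → IsPartialOrder.reflexive po refl }
      ; trans = IsPartialOrder.trans po
      }
    ; antisym = λ p q → emb-injective S _ _ (IsPartialOrder.antisym po p q)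
    }

  module Standardization {n} (S : Subset n) (A : Fin n → ℕ) where

    private
      e = emb S

    st≡suc-count : ∀ i → st A S i ≡ suc (count ∣ S ∣ (λ j → A (e j) <? A (e i)))
    st≡suc-count i = cong suc (length-filter-tabulate ∣ S ∣ (λ j → j) (λ j → A (e j) <? A (e i)))

    st-mono-< : ∀ i j → A (e i) < A (e j) → st A S i < st A S j
    st-mono-< i j lt = subst₂ _<_ (sym (st≡suc-count i)) (sym (st≡suc-count j))
      (s≤s (count-mono-< (λ k → A (e k) <? A (e i)) (λ k → A (e k) <? A (e j))
                           (λ k p → <-trans p lt) i lt (<-irrefl refl)))

    st-mono-≤ : ∀ i j → A (e i) ≤ A (e j) → st A S i ≤ st A S j
    st-mono-≤ i j le = subst₂ _≤_ (sym (st≡suc-count i)) (sym (st≡suc-count j))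
      (s≤s (count-mono (λ k → A (e k) <? A (e i)) (λ k → A (e k) <? A (e j)) (λ k p → <-≤-trans p le)))

    st-cancel-< : ∀ i j → st A S i < st A S j → A (e i) < A (e j)
    st-cancel-< i j lt with A (e i) <? A (e j)
    ... | yes p = p
    ... | no ¬p = contradiction (st-mono-≤ j i (≮⇒≥ ¬p)) (<⇒≱ lt)

    st-cancel-≤ : ∀ i j → st A S i ≤ st A S j → A (e i) ≤ A (e j)
    st-cancel-≤ i j le with A (e i) ≤? A (e j)
    ... | yes p = p
    ... | no ¬p = contradiction le (<⇒≱ (st-mono-< j i (≰⇒> ¬p)))

    st-isLabeling : IsLabeling n A → IsLabeling ∣ S ∣ (st A S)
    st-isLabeling lab = injective⇒labeling (st A S) bounds st-injective
      where
      always : Fin ∣ S ∣ → Dec ⊤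
      always _ = yes tt
      bounds : ∀ i → 1 ≤ st A S i × st A S i ≤ ∣ S ∣
      bounds i = subst (λ t → 1 ≤ t × t ≤ ∣ S ∣) (sym (st≡suc-count i))
        (s≤s z≤n , ≤-trans (count-mono-< _ always (λ _ _ → tt) i tt (<-irrefl refl))
                            (≤-reflexive (count-all always (λ _ → tt))))
      st-injective : ∀ i j → st A S i ≡ st A S j → i ≡ j
      st-injective i j eq =
        emb-injective S i j (label-injective lab _ _
          (≤-antisym (st-cancel-≤ i j (≤-reflexive eq)) (st-cancel-≤ j i (≤-reflexive (sym eq)))))

  module _ {n} (S : Subset n) where

    private
      e = emb S

    st-cong : (A B : Fin n → ℕ) →
      (∀ i j → A (e i) < A (e j) → B (e i) < B (e j)) →
      (∀ i j → B (e i) < B (e j) → A (e i) < A (e j)) →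
      ∀ i → st A S i ≡ st B S i
    st-cong A B A⇒B B⇒A i = begin
      st A S i
        ≡⟨ Standardization.st≡suc-count S A i ⟩
      suc (count ∣ S ∣ (λ j → A (e j) <? A (e i)))
        ≡⟨ cong suc (count-cong (λ j → A (e j) <? A (e i)) (λ j → B (e j) <? B (e i)) (λ j → A⇒B j i) (λ j → B⇒A j i)) ⟩
      suc (count ∣ S ∣ (λ j → B (e j) <? B (e i)))
        ≡⟨ Standardization.st≡suc-count S B i ⟨
      st B S i ∎
      where open ≡-Reasoning

    st-≗ : {A B : Fin n → ℕ} → (∀ x → A x ≡ B x) → ∀ i → st A S i ≡ st B S i
    st-≗ {A} {B} A≗B = st-cong A B (λ i j → subst₂ _<_ (A≗B (e i)) (A≗B (e j)))
                           (λ i j → subst₂ _<_ (sym (A≗B (e i))) (sym (A≗B (e j))))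

    st-unique : (A : Fin n → ℕ) (K : Fin ∣ S ∣ → ℕ) → IsLabeling ∣ S ∣ K →
      (∀ i j → A (e i) < A (e j) → K i < K j) →
      (∀ i j → K i < K j → A (e i) < A (e j)) →
      ∀ i → st A S i ≡ K i
    st-unique A K lab A⇒K K⇒A i = begin
      st A S i
        ≡⟨ Standardization.st≡suc-count S A i ⟩
      suc (count ∣ S ∣ (λ j → A (e j) <? A (e i)))
        ≡⟨ cong suc (count-cong (λ j → A (e j) <? A (e i)) (λ j → K j <? K i) (λ j → A⇒K j i) (λ j → K⇒A j i)) ⟩
      suc (count ∣ S ∣ (λ j → K j <? K i))
        ≡⟨ label≡suc-count-smaller lab i ⟨
      K i ∎
      where open ≡-Reasoning

  findFirst-just : ∀ {m} {Q : Fin m → Set} (Q? : ∀ x → Dec (Q x)) {v} → findFirst Q? ≡ just v → Q v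
  findFirst-just {suc m} Q? eq with Q? zero
  findFirst-just {suc m} Q? refl | yes q = q
  ... | no _ with findFirst (Q? ∘ suc) in found
  findFirst-just {suc m} Q? refl | no _ | just x = findFirst-just (Q? ∘ suc) found

  findFirst-nothing : ∀ {m} {Q : Fin m → Set} (Q? : ∀ x → Dec (Q x)) →
    findFirst Q? ≡ nothing → ∀ x → ¬ Q x
  findFirst-nothing {suc m} Q? eq x q with Q? zero
  findFirst-nothing {suc m} Q? () x q | yes _
  ... | no ¬q0 with findFirst (Q? ∘ suc) in found
  findFirst-nothing {suc m} Q? refl zero q | no ¬q0 | nothing = ¬q0 q
  findFirst-nothing {suc m} Q? refl (suc x) q | no _ | nothing = findFirst-nothing (Q? ∘ suc) found x q

  findFirst-cong : ∀ {m} {Q R : Fin m → Set} (Q? : ∀ x → Dec (Q x)) (R? : ∀ x → Dec (R x)) →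
    (∀ x → does (Q? x) ≡ does (R? x)) → findFirst Q? ≡ findFirst R?
  findFirst-cong {zero} Q? R? same = refl
  findFirst-cong {suc m} Q? R? same with does (Q? zero) | does (R? zero) | same zero
  ... | true | _ | refl = refl
  ... | false | _ | refl
    with findFirst (λ x → Q? (suc x)) | findFirst (λ x → R? (suc x))
       | findFirst-cong (Q? ∘ suc) (R? ∘ suc) (same ∘ suc)
  ...  | just x | _ | refl = refl
  ...  | nothing | _ | refl = refl

  module _ {m} (L : Fin m → ℕ) where

    minBy-nothing : ∀ ys → minBy L ys ≡ nothing → ∀ y → y ∉ₗ ys
    minBy-nothing (y ∷ ys) eq with minBy L ys
    minBy-nothing (y ∷ ys) () | nothing
    minBy-nothing (y ∷ ys) eq | just z with L y ℕ.≤ᵇ L z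
    minBy-nothing (y ∷ ys) () | just z | true
    minBy-nothing (y ∷ ys) () | just z | false

    minBy-just : ∀ ys {w} → minBy L ys ≡ just w → w ∈ₗ ys × (∀ y → y ∈ₗ ys → L w ≤ L y)
    minBy-just (x ∷ xs) eq with minBy L xs in found
    minBy-just (x ∷ xs) refl | nothing =
      here refl , λ { y (here refl) → ≤-refl ; y (there p) → contradiction p (minBy-nothing xs found y) }
    ... | just z with L x ℕ.≤ᵇ L z in x≤ᵇz | minBy-just xs found
    minBy-just (x ∷ xs) refl | just z | true | z∈ , z-min =
      here refl , λ { y (here refl) → ≤-refl ; y (there q) → ≤-trans x≤z (z-min y q) }
      where x≤z = ≤ᵇ⇒≤ (L x) (L z) (subst T (sym x≤ᵇz) tt)
    minBy-just (x ∷ xs) refl | just z | false | z∈ , z-min =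
      there z∈ , λ { y (here refl) → <⇒≤ (≰⇒> x≰z) ; y (there q) → z-min y q }
      where x≰z = λ x≤z → subst T x≤ᵇz (≤⇒≤ᵇ x≤z)

  minBy-cong : ∀ {m} {L L′ : Fin m → ℕ} → (∀ x → L x ≡ L′ x) → ∀ ys → minBy L ys ≡ minBy L′ ys
  minBy-cong L≗L′ [] = refl
  minBy-cong {L = L} {L′} L≗L′ (x ∷ xs) rewrite minBy-cong L≗L′ xs with minBy L′ xs
  ... | nothing = refl
  ... | just y rewrite L≗L′ x | L≗L′ y = refl

  module _ {n} (P : FinRel n) {L L′ : Fin n → ℕ} (L≗L′ : ∀ x → L x ≡ L′ x) where

    successor-cong : ∀ x → successor P L x ≡ successor P L′ x
    successor-cong x = minBy-cong L≗L′ (filter (_<P?_ P x) (allFin n))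

    chainFrom-cong : ∀ k v → chainFrom P L k v ≡ chainFrom P L′ k v
    chainFrom-cong zero v = refl
    chainFrom-cong (suc k) v rewrite successor-cong v with successor P L′ v
    ... | nothing = refl
    ... | just w = cong (v ∷_) (chainFrom-cong k w)

    promotionChain-cong : promotionChain P L ≡ promotionChain P L′
    promotionChain-cong
      rewrite findFirst-cong (λ x → L x ℕ.≟ 1) (λ x → L′ x ℕ.≟ 1)
                             (λ x → cong (λ a → does (a ℕ.≟ 1)) (L≗L′ x))
      with findFirst (λ x → L′ x ℕ.≟ 1)
    ... | nothing = refl
    ... | just v = chainFrom-cong n v

    ∂at-cong : ∀ vs x → ∂at L vs x ≡ ∂at L′ vs x
    ∂at-cong [] x = cong (_∸ 1) (L≗L′ x)
    ∂at-cong (v ∷ []) x = cong (λ a → if does (x Fin.≟ v) then n else a) (cong (_∸ 1) (L≗L′ x))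
    ∂at-cong (v ∷ w ∷ vs) x =
      cong₂ (λ a b → if does (x Fin.≟ v) then a else b) (cong (_∸ 1) (L≗L′ w)) (∂at-cong (w ∷ vs) x)

    ∂-cong : ∀ x → ∂ P L x ≡ ∂ P L′ x
    ∂-cong x = trans (∂at-cong (promotionChain P L) x) (cong (λ vs → ∂at L′ vs x) promotionChain-cong)

  iter-∂-cong : ∀ {n} (P : FinRel n) k {L L′ : Fin n → ℕ} → (∀ x → L x ≡ L′ x) →
    ∀ x → iter k (∂ P) L x ≡ iter k (∂ P) L′ x
  iter-∂-cong P zero L≗L′ = L≗L′
  iter-∂-cong P (suc k) L≗L′ = ∂-cong P (iter-∂-cong P k L≗L′)

  -- Extended promotion

  module Promotion {n} (P : FinRel n) (po : IsPartialOrder _≡_ (_≤P_ P)) where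

    infix 4 _⊑_ _⊏_ _⊏?_

    _⊑_ _⊏_ : Fin n → Fin n → Set
    _⊑_ = _≤P_ P
    _⊏_ = _<P_ P

    _⊏?_ : ∀ x y → Dec (x ⊏ y)
    _⊏?_ = _<P?_ P

    ⊑-refl : ∀ {x} → x ⊑ x
    ⊑-refl = IsPartialOrder.reflexive po refl

    ⊑-trans : ∀ {x y z} → x ⊑ y → y ⊑ z → x ⊑ z
    ⊑-trans = IsPartialOrder.trans po

    ⊏-irrefl : ∀ {x} → ¬ (x ⊏ x)
    ⊏-irrefl (_ , x≢x) = x≢x refl

    ⊏-⊑-trans : ∀ {x y z} → x ⊏ y → y ⊑ z → x ⊏ z
    ⊏-⊑-trans (x⊑y , x≢y) y⊑z = ⊑-trans x⊑y y⊑z , λ { refl → x≢y (IsPartialOrder.antisym po x⊑y y⊑z) }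

    ⊑-⊏-trans : ∀ {x y z} → x ⊑ y → y ⊏ z → x ⊏ z
    ⊑-⊏-trans x⊑y (y⊑z , y≢z) = ⊑-trans x⊑y y⊑z , λ { refl → y≢z (IsPartialOrder.antisym po y⊑z x⊑y) }

    ⊏-trans : ∀ {x y z} → x ⊏ y → y ⊏ z → x ⊏ z
    ⊏-trans x⊏y (y⊑z , _) = ⊏-⊑-trans x⊏y y⊑z

    Maximal : Fin n → Set
    Maximal v = ∀ y → ¬ (v ⊏ y)

    TopSorted : ℕ → (Fin n → ℕ) → Set
    TopSorted k A = ∀ x y → x ⊏ y → n < A x + k → A x < A y

    module _ (L : Fin n → ℕ) where

      IsSuccessor : Fin n → Fin n → Set
      IsSuccessor v w = v ⊏ w × (∀ y → v ⊏ y → L w ≤ L y)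

      successor-just : ∀ {v w} → successor P L v ≡ just w → IsSuccessor v w
      successor-just {v} eq with minBy-just L _ eq
      ... | w∈ , w-min = proj₂ (∈-filter⁻ (v ⊏?_) {xs = allFin n} w∈)
                       , λ y v⊏y → w-min y (∈-filter⁺ (v ⊏?_) (∈-allFin y) v⊏y)

      successor-nothing : ∀ {v} → successor P L v ≡ nothing → Maximal v
      successor-nothing {v} eq y v⊏y = minBy-nothing L _ eq y (∈-filter⁺ (v ⊏?_) (∈-allFin y) v⊏y)

      data OnChain : Fin n → Set where
        start : ∀ {x} → L x ≡ 1 → OnChain x
        next : ∀ {v w} → OnChain v → IsSuccessor v w → OnChain w

      data ChainFrom : Fin n → List (Fin n) → Set where
        end : ∀ {v} → Maximal v → ChainFrom v [ v ]
        step : ∀ {v w vs} → IsSuccessor v w → ChainFrom w vs → ChainFrom v (v ∷ vs)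

      -- The fuel suffices: the number of elements above drops along the chain.
      chainFrom-ChainFrom : ∀ k v → count n (v ⊏?_) ≤ k → ChainFrom v (chainFrom P L k v)
      chainFrom-ChainFrom zero v none-above =
        end λ y v⊏y → 1+n≰n (≤-trans (count-pos (v ⊏?_) y v⊏y) none-above)
      chainFrom-ChainFrom (suc k) v ≤suc-k with successor P L v in eq
      ... | nothing = end (successor-nothing eq)
      ... | just w = step v→w (chainFrom-ChainFrom k w (≤-pred (≤-trans fewer ≤suc-k)))
        where
        v→w = successor-just eq
        fewer : count n (w ⊏?_) < count n (v ⊏?_)
        fewer = count-mono-< (w ⊏?_) (v ⊏?_) (λ y → ⊏-trans (proj₁ v→w)) w (proj₁ v→w) ⊏-irrefl

      ChainFrom-head : ∀ {v vs} → ChainFrom v vs → v ∈ₗ vs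
      ChainFrom-head (end _) = here refl
      ChainFrom-head (step _ _) = here refl

      ChainFrom-above : ∀ {v vs y} → ChainFrom v vs → y ∈ₗ vs → v ⊑ y
      ChainFrom-above (end _) (here refl) = ⊑-refl
      ChainFrom-above (step _ _) (here refl) = ⊑-refl
      ChainFrom-above (step (v⊏w , _) c) (there y∈) = proj₁ (⊏-⊑-trans v⊏w (ChainFrom-above c y∈))

      ChainFrom-shape : ∀ {w vs} → ChainFrom w vs → ∃ λ us → vs ≡ w ∷ us
      ChainFrom-shape (end _) = _ , refl
      ChainFrom-shape (step _ _) = _ , refl

      ∂at-skip : ∀ {v w us x} → x ≢ v → ∂at L (v ∷ w ∷ us) x ≡ ∂at L (w ∷ us) x
      ∂at-skip {v} {x = x} x≢v with x Fin.≟ v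
      ... | yes x≡v = contradiction x≡v x≢v
      ... | no _ = refl

      ∂at-hit : ∀ {v w us} → ∂at L (v ∷ w ∷ us) v ≡ L w ∸ 1
      ∂at-hit {v} with v Fin.≟ v
      ... | yes _ = refl
      ... | no v≢v = contradiction refl v≢v

      ∂at-off : ∀ {v vs} → ChainFrom v vs → ∀ x → x ∉ₗ vs → ∂at L vs x ≡ L x ∸ 1
      ∂at-off {v} (end _) x x∉ with x Fin.≟ v
      ... | yes refl = contradiction (here refl) x∉
      ... | no _ = refl
      ∂at-off {v} (step {w = w} _ c) x x∉ with ChainFrom-shape c
      ... | us , refl =
        trans (∂at-skip {v} {w} {us} (λ { refl → x∉ (here refl) })) (∂at-off c x (x∉ ∘ there))

      ∂at-on : ∀ {v vs} → ChainFrom v vs → ∀ x → x ∈ₗ vs →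
        (∃ λ w → IsSuccessor x w × ∂at L vs x ≡ L w ∸ 1) ⊎ (Maximal x × ∂at L vs x ≡ n)
      ∂at-on (end v-max) x (here refl) with x Fin.≟ x
      ... | yes _ = inj₂ (v-max , refl)
      ... | no x≢x = contradiction refl x≢x
      ∂at-on (step {w = w} v→w c) x x∈ with ChainFrom-shape c
      ∂at-on (step {w = w} v→w c) x (here refl) | us , refl = inj₁ (w , v→w , ∂at-hit {x} {w} {us})
      ∂at-on {v} (step {w = w} v→w c) x (there x∈) | us , refl with x Fin.≟ v
      ... | yes refl = inj₁ (w , v→w , refl)
      ... | no _ = ∂at-on c x x∈

    OnChain-above-start : ∀ {L} → (∀ x y → L x ≡ L y → x ≡ y) → ∀ {u} → L u ≡ 1 →
      ∀ {x} → OnChain L x → u ⊑ x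
    OnChain-above-start injective Lu≡1 (start Lx≡1) =
      subst (_ ⊑_) (injective _ _ (trans Lu≡1 (sym Lx≡1))) ⊑-refl
    OnChain-above-start injective Lu≡1 (next on-v (v⊏w , _)) =
      ⊑-trans (OnChain-above-start injective Lu≡1 on-v) (proj₁ v⊏w)

    module _ {L : Fin n → ℕ} (lab : IsLabeling n L) where

      private
        chain = promotionChain P L
        injective = label-injective lab

        tail : ∀ {y z : Fin n} {zs} → y ≢ z → y ∈ₗ z ∷ zs → y ∈ₗ zs
        tail y≢z (here refl) = contradiction refl y≢z
        tail _ (there y∈) = y∈

      successor-unique : ∀ {x w w′} → IsSuccessor L x w → IsSuccessor L x w′ → w ≡ w′
      successor-unique (x⊏w , w-min) (x⊏w′ , w′-min) = injective _ _ (≤-antisym (w-min _ x⊏w′) (w′-min _ x⊏w))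

      promotionChain-ChainFrom : Fin n → ∃ λ v₁ → L v₁ ≡ 1 × ChainFrom L v₁ chain
      promotionChain-ChainFrom x₀ with findFirst (λ x → L x ℕ.≟ 1) in found
      ... | just v = v , findFirst-just (λ x → L x ℕ.≟ 1) found , chainFrom-ChainFrom L n v (count≤ (v ⊏?_))
      ... | nothing = contradiction (proj₂ one) (findFirst-nothing (λ x → L x ℕ.≟ 1) found (proj₁ one))
        where one = element-labeled lab 1 ≤-refl (≤-trans (s≤s z≤n) (toℕ<n x₀))

      ChainFrom-successor-closed : ∀ {v vs x w} → ChainFrom L v vs → x ∈ₗ vs → IsSuccessor L x w → w ∈ₗ vs
      ChainFrom-successor-closed (end v-max) (here refl) (x⊏w , _) = contradiction x⊏w (v-max _)
      ChainFrom-successor-closed {v} {x = x} (step v→u c) x∈ x→w with x Fin.≟ v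
      ... | yes refl = there (subst (_∈ₗ _) (successor-unique v→u x→w) (ChainFrom-head L c))
      ... | no x≢v = there (ChainFrom-successor-closed c (tail x≢v x∈) x→w)

      ChainFrom-predecessor-unique : ∀ {v vs x y w} → ChainFrom L v vs → x ∈ₗ vs → y ∈ₗ vs →
        IsSuccessor L x w → IsSuccessor L y w → x ≡ y
      ChainFrom-predecessor-unique (end _) (here refl) (here refl) _ _ = refl
      ChainFrom-predecessor-unique {v} {x = x} {y} (step v→u c) x∈ y∈ x→w y→w with x Fin.≟ v | y Fin.≟ v
      ... | yes refl | yes refl = refl
      ... | yes refl | no y≢v = contradiction (⊑-⊏-trans (ChainFrom-above L c (tail y≢v y∈))
                                  (subst (y ⊏_) (successor-unique x→w v→u) (proj₁ y→w))) ⊏-irrefl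
      ... | no x≢v | yes refl = contradiction (⊑-⊏-trans (ChainFrom-above L c (tail x≢v x∈))
                                  (subst (x ⊏_) (successor-unique y→w v→u) (proj₁ x→w))) ⊏-irrefl
      ... | no x≢v | no y≢v = ChainFrom-predecessor-unique c (tail x≢v x∈) (tail y≢v y∈) x→w y→w

      ChainFrom-maximal-unique : ∀ {v vs x y} → ChainFrom L v vs → x ∈ₗ vs → y ∈ₗ vs →
        Maximal x → Maximal y → x ≡ y
      ChainFrom-maximal-unique (end _) (here refl) (here refl) _ _ = refl
      ChainFrom-maximal-unique {v} {x = x} {y} (step v→u c) x∈ y∈ x-max y-max with x Fin.≟ v | y Fin.≟ v
      ... | yes refl | _ = contradiction (proj₁ v→u) (x-max _)
      ... | no _ | yes refl = contradiction (proj₁ v→u) (y-max _)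
      ... | no x≢v | no y≢v = ChainFrom-maximal-unique c (tail x≢v x∈) (tail y≢v y∈) x-max y-max

      OnChain⇒∈ : ∀ {x} → OnChain L x → x ∈ₗ chain
      OnChain⇒∈ {x} (start Lx≡1) with promotionChain-ChainFrom x
      ... | v₁ , Lv₁≡1 , c =
        subst (_∈ₗ chain) (injective v₁ x (trans Lv₁≡1 (sym Lx≡1))) (ChainFrom-head L c)
      OnChain⇒∈ {x} (next on v→x) =
        ChainFrom-successor-closed (proj₂ (proj₂ (promotionChain-ChainFrom x))) (OnChain⇒∈ on) v→x

      ∈⇒OnChain : ∀ {x} → x ∈ₗ chain → OnChain L x
      ∈⇒OnChain {x} x∈ with promotionChain-ChainFrom x
      ... | v₁ , Lv₁≡1 , c = from c (start Lv₁≡1) x∈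
        where
        from : ∀ {v vs y} → ChainFrom L v vs → OnChain L v → y ∈ₗ vs → OnChain L y
        from (end _) on (here refl) = on
        from (step _ _) on (here refl) = on
        from (step v→w c) on (there y∈) = from c (next on v→w) y∈

      OnChain? : ∀ x → Dec (OnChain L x)
      OnChain? x with Any.any? (x Fin.≟_) chain
      ... | yes x∈ = yes (∈⇒OnChain x∈)
      ... | no x∉ = no (x∉ ∘ OnChain⇒∈)

      OnChain-predecessor-unique : ∀ {x y w} → OnChain L x → OnChain L y →
        IsSuccessor L x w → IsSuccessor L y w → x ≡ y
      OnChain-predecessor-unique {x} on-x on-y = ChainFrom-predecessor-unique
        (proj₂ (proj₂ (promotionChain-ChainFrom x))) (OnChain⇒∈ on-x) (OnChain⇒∈ on-y)

      OnChain-maximal-unique : ∀ {x y} → OnChain L x → OnChain L y → Maximal x → Maximal y → x ≡ y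
      OnChain-maximal-unique {x} on-x on-y = ChainFrom-maximal-unique
        (proj₂ (proj₂ (promotionChain-ChainFrom x))) (OnChain⇒∈ on-x) (OnChain⇒∈ on-y)

      ∂-off : ∀ {x} → ¬ OnChain L x → ∂ P L x ≡ L x ∸ 1
      ∂-off {x} off = ∂at-off L (proj₂ (proj₂ (promotionChain-ChainFrom x))) x (off ∘ ∈⇒OnChain)

      ∂-next : ∀ {x w} → OnChain L x → IsSuccessor L x w → ∂ P L x ≡ L w ∸ 1
      ∂-next {x} on x→w with ∂at-on L (proj₂ (proj₂ (promotionChain-ChainFrom x))) x (OnChain⇒∈ on)
      ... | inj₁ (u , x→u , eq) = trans eq (cong (λ z → L z ∸ 1) (successor-unique x→u x→w))
      ... | inj₂ (x-max , _) = contradiction (proj₁ x→w) (x-max _)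

      ∂-top : ∀ {x} → OnChain L x → Maximal x → ∂ P L x ≡ n
      ∂-top {x} on x-max with ∂at-on L (proj₂ (proj₂ (promotionChain-ChainFrom x))) x (OnChain⇒∈ on)
      ... | inj₁ (u , x→u , _) = contradiction (proj₁ x→u) (x-max _)
      ... | inj₂ (_ , eq) = eq

      data ∂-View (x : Fin n) : Set where
        off : ¬ OnChain L x → ∂ P L x ≡ L x ∸ 1 → ∂-View x
        on : ∀ {w} → OnChain L x → IsSuccessor L x w → ∂ P L x ≡ L w ∸ 1 → ∂-View x
        top : OnChain L x → Maximal x → ∂ P L x ≡ n → ∂-View x

      ∂-view : ∀ x → ∂-View x
      ∂-view x with OnChain? x | successor P L x in eq
      ... | no off-x | _ = off off-x (∂-off off-x)
      ... | yes on-x | just w = on on-x (successor-just L eq) (∂-next on-x (successor-just L eq))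
      ... | yes on-x | nothing = top on-x (successor-nothing L eq) (∂-top on-x (successor-nothing L eq))

      private
        label-∸1<n : ∀ z → L z ∸ 1 < n
        label-∸1<n z = ∸1<bound (label-pos lab z) (label≤ lab z)

        2≤label : ∀ {z} → ¬ (L z ≡ 1) → 2 ≤ L z
        2≤label {z} Lz≢1 = ≤∧≢⇒< (label-pos lab z) (Lz≢1 ∘ sym)

      2≤label-off : ∀ {x} → ¬ OnChain L x → 2 ≤ L x
      2≤label-off off-x = 2≤label (off-x ∘ start)

      2≤label-successor : ∀ {x w} → OnChain L x → IsSuccessor L x w → 2 ≤ L w
      2≤label-successor on-x (x⊏w , _) =
        2≤label λ Lw≡1 → ⊏-irrefl (⊑-⊏-trans (OnChain-above-start injective Lw≡1 on-x) x⊏w)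

      ∂-isLabeling : IsLabeling n (∂ P L)
      ∂-isLabeling = injective⇒labeling (∂ P L) bounds (λ x y eq → views-injective eq (∂-view x) (∂-view y))
        where
        bounds-∸1 : ∀ {z} → 2 ≤ L z → 1 ≤ L z ∸ 1 × L z ∸ 1 ≤ n
        bounds-∸1 {z} 2≤Lz = ∸-monoˡ-≤ 1 2≤Lz , ≤-trans (m∸n≤m (L z) 1) (label≤ lab z)

        bounds : ∀ x → 1 ≤ ∂ P L x × ∂ P L x ≤ n
        bounds x with ∂-view x
        ... | off off-x eq = subst (λ t → 1 ≤ t × t ≤ n) (sym eq) (bounds-∸1 (2≤label-off off-x))
        ... | on on-x x→w eq = subst (λ t → 1 ≤ t × t ≤ n) (sym eq) (bounds-∸1 (2≤label-successor on-x x→w))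
        ... | top _ _ eq = subst (λ t → 1 ≤ t × t ≤ n) (sym eq) (≤-trans (s≤s z≤n) (toℕ<n x) , ≤-refl)

        module _ {x y : Fin n} (eq : ∂ P L x ≡ ∂ P L y) where

          same-label : ∀ {a b} → ∂ P L x ≡ L a ∸ 1 → ∂ P L y ≡ L b ∸ 1 → a ≡ b
          same-label {a} {b} eqa eqb = injective a b
            (∸1-injective (label-pos lab a) (label-pos lab b) (trans (sym eqa) (trans eq eqb)))

          not-top : ∀ {a} → ∂ P L x ≡ L a ∸ 1 → ∂ P L y ≡ n → ⊥
          not-top {a} eqa eqn = <-irrefl (trans (sym eqa) (trans eq eqn)) (label-∸1<n a)

          not-top′ : ∀ {b} → ∂ P L x ≡ n → ∂ P L y ≡ L b ∸ 1 → ⊥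
          not-top′ {b} eqn eqb = <-irrefl (trans (sym eqb) (trans (sym eq) eqn)) (label-∸1<n b)

          views-injective : ∂-View x → ∂-View y → x ≡ y
          views-injective (off _ ex) (off _ ey) = same-label ex ey
          views-injective (off off-x ex) (on on-y y→w ey) with same-label ex ey
          ... | refl = contradiction (next on-y y→w) off-x
          views-injective (on on-x x→w ex) (off off-y ey) with same-label ex ey
          ... | refl = contradiction (next on-x x→w) off-y
          views-injective (on on-x x→w ex) (on on-y y→w′ ey) with same-label ex ey
          ... | refl = OnChain-predecessor-unique on-x on-y x→w y→w′
          views-injective (top on-x x-max _) (top on-y y-max _) = OnChain-maximal-unique on-x on-y x-max y-max
          views-injective (off _ ex) (top _ _ ey) = ⊥-elim (not-top ex ey)
          views-injective (on _ _ ex) (top _ _ ey) = ⊥-elim (not-top ex ey)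
          views-injective (top _ _ ex) (off _ ey) = ⊥-elim (not-top′ ex ey)
          views-injective (top _ _ ex) (on _ _ ey) = ⊥-elim (not-top′ ex ey)

      private
        module _ {x y : Fin n} where
          ∸1-< : ∀ {a b} → ∂ P L x ≡ L a ∸ 1 → ∂ P L y ≡ L b ∸ 1 → L a < L b → ∂ P L x < ∂ P L y
          ∸1-< {a} ex ey La<Lb = subst₂ _<_ (sym ex) (sym ey) (∸1-mono-< (label-pos lab a) La<Lb)

          ∸1-<n : ∀ {a} → ∂ P L x ≡ L a ∸ 1 → ∂ P L y ≡ n → ∂ P L x < ∂ P L y
          ∸1-<n {a} ex ey = subst₂ _<_ (sym ex) (sym ey) (label-∸1<n a)

        unpromote-high : ∀ {x k} → ∂ P L x ≡ L x ∸ 1 → n < ∂ P L x + suc k → n < L x + k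
        unpromote-high {x} {k} ex = subst (n <_) (begin
          ∂ P L x + suc k    ≡⟨ cong (_+ suc k) ex ⟩
          L x ∸ 1 + suc k    ≡⟨ +-suc (L x ∸ 1) k ⟩
          suc (L x ∸ 1) + k  ≡⟨ cong (_+ k) (suc-∸1 (label-pos lab x)) ⟩
          L x + k            ∎)
          where open ≡-Reasoning

      ∂-TopSorted : ∀ k → TopSorted k L → TopSorted (suc k) (∂ P L)
      ∂-TopSorted k sorted x y x⊏y high with ∂-view x | ∂-view y
      ... | top _ x-max _ | _ = contradiction x⊏y (x-max y)
      ... | off _ ex | off _ ey = ∸1-< ex ey (sorted x y x⊏y (unpromote-high ex high))
      ... | off _ ex | on _ y→w ey =
        ∸1-< ex ey (sorted x _ (⊏-trans x⊏y (proj₁ y→w)) (unpromote-high ex high))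
      ... | off _ ex | top _ _ ey = ∸1-<n ex ey
      ... | on on-x x→w ex | off off-y ey = ∸1-< ex ey (≤∧≢⇒< (proj₂ x→w y x⊏y)
        λ Lw≡Ly → off-y (subst (OnChain L) (injective _ _ Lw≡Ly) (next on-x x→w)))
      ... | on on-x x→w ex | on on-y y→w′ ey = ∸1-< ex ey (≤∧≢⇒< (proj₂ x→w _ (⊏-trans x⊏y (proj₁ y→w′)))
        λ Lw≡Lw′ → ⊏-irrefl (subst (_⊏ y) (OnChain-predecessor-unique on-x on-y x→w
                     (subst (IsSuccessor L y) (sym (injective _ _ Lw≡Lw′)) y→w′)) x⊏y))
      ... | on _ _ ex | top _ _ ey = ∸1-<n ex ey

    iter-∂-isLabeling : ∀ k {L} → IsLabeling n L → IsLabeling n (iter k (∂ P) L)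
    iter-∂-isLabeling zero lab = lab
    iter-∂-isLabeling (suc k) lab = ∂-isLabeling (iter-∂-isLabeling k lab)

    iter-∂-TopSorted : ∀ k {L} → IsLabeling n L → TopSorted k (iter k (∂ P) L)
    iter-∂-TopSorted zero lab x y _ n<Lx+0 =
      contradiction (subst (_≤ n) (sym (+-identityʳ _)) (label≤ lab x)) (<⇒≱ n<Lx+0)
    iter-∂-TopSorted (suc k) lab = ∂-TopSorted (iter-∂-isLabeling k lab) k (iter-∂-TopSorted k lab)

    TopSorted⇒IsLinExt : ∀ {A} → IsLabeling n A → TopSorted (n ∸ 1) A → IsLinExt P A
    TopSorted⇒IsLinExt {A} lab sorted x y x⊑y with x Fin.≟ y | A x ℕ.≟ 1
    ... | yes refl | _ = ≤-refl
    ... | no _ | yes Ax≡1 = subst (_≤ A y) (sym Ax≡1) (label-pos lab y)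
    ... | no x≢y | no Ax≢1 = <⇒≤ (sorted x y (x⊑y , x≢y) (begin-strict
      n                  ≡⟨ suc-∸1 (≤-trans (s≤s z≤n) (toℕ<n x)) ⟨
      suc (n ∸ 1)        <⟨ +-monoˡ-≤ (n ∸ 1) (≤∧≢⇒< (label-pos lab x) (Ax≢1 ∘ sym)) ⟩
      A x + (n ∸ 1)      ∎))
      where open ≤-Reasoning

    iter-∂-IsLinExt : ∀ j {L} → IsLabeling n L → n ∸ 1 ≤ j → IsLinExt P (iter j (∂ P) L)
    iter-∂-IsLinExt j lab n∸1≤j = TopSorted⇒IsLinExt (iter-∂-isLabeling j lab)
      λ x y x⊏y high → iter-∂-TopSorted j lab x y x⊏y (≤-trans high (+-monoʳ-≤ _ n∸1≤j))

  -- Connected components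

  module Components {n} (P : FinRel n) (po : IsPartialOrder _≡_ (_≤P_ P)) where

    open Promotion P po

    private
      between? : ∀ x y z → Dec (x ⊏ z × z ⊏ y)
      between? x y z = (x ⊏? z) ×-dec (z ⊏? y)

    -- Induction on the number of elements strictly between x and y.
    ⊏⇒Connected : ∀ {x y} → x ⊏ y → Connected P x y
    ⊏⇒Connected {x} {y} = go (suc (count n (between? x y))) ≤-refl
      where
      go : ∀ k {x y} → count n (between? x y) < k → x ⊏ y → Connected P x y
      go (suc k) {x} {y} fewer x⊏y with Finₚ.any? (between? x y)
      ... | no none = inj₁ (x⊏y , λ z x⊏z z⊏y → none (z , x⊏z , z⊏y)) ◅ ε
      ... | yes (z , x⊏z , z⊏y) = go k left x⊏z ◅◅ go k right z⊏y
        where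
        left : count n (between? x z) < k
        left = ≤-trans (count-mono-< (between? x z) (between? x y) (λ w (x⊏w , w⊏z) → x⊏w , ⊏-trans w⊏z z⊏y)
                          z (x⊏z , z⊏y) (⊏-irrefl ∘ proj₂)) (≤-pred fewer)
        right : count n (between? z y) < k
        right = ≤-trans (count-mono-< (between? z y) (between? x y) (λ w (z⊏w , w⊏y) → ⊏-trans x⊏z z⊏w , w⊏y)
                           z (x⊏z , z⊏y) (⊏-irrefl ∘ proj₁)) (≤-pred fewer)

    ⊑⇒Connected : ∀ {x y} → x ⊑ y → Connected P x y
    ⊑⇒Connected {x} {y} x⊑y with x Fin.≟ y
    ... | yes refl = ε
    ... | no x≢y = ⊏⇒Connected (x⊑y , x≢y)

    Connected-sym : ∀ {x y} → Connected P x y → Connected P y x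
    Connected-sym = reverse λ { (inj₁ x⋖y) → inj₂ x⋖y ; (inj₂ y⋖x) → inj₁ y⋖x }

    module _ {S : Subset n} (S-component : IsComponent P S) where

      Connected-closed : ∀ {x y} → x ∈ S → Connected P x y → y ∈ S
      Connected-closed x∈S = Equivalence.from (proj₂ S-component _ _ x∈S)

      ⊑-closed : ∀ {x y} → x ⊑ y → (x ∈ S → y ∈ S) × (y ∈ S → x ∈ S)
      ⊑-closed x⊑y = (λ x∈S → Connected-closed x∈S (⊑⇒Connected x⊑y))
                   , (λ y∈S → Connected-closed y∈S (Connected-sym (⊑⇒Connected x⊑y)))

    module _ {r} {C : Fin r → Subset n} (components : AreComponents P r C) where

      component-unique : ∀ {i j x} → x ∈ C i → x ∈ C j → i ≡ j
      component-unique {i} {j} {x} x∈Ci x∈Cj = proj₁ (proj₂ components) i j (⊆-antisym (same x∈Ci x∈Cj) (same x∈Cj x∈Ci))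
        where
        same : ∀ {i j} → x ∈ C i → x ∈ C j → ∀ {y} → y ∈ C i → y ∈ C j
        same {i} {j} x∈Ci x∈Cj y∈Ci = Connected-closed (proj₁ components j) x∈Cj
          (Equivalence.to (proj₂ (proj₁ components i) x _ x∈Ci) y∈Ci)

      componentOf : Fin n → Fin r
      componentOf x = proj₁ (proj₂ (proj₂ components) x)

      ∈-componentOf : ∀ x → x ∈ C (componentOf x)
      ∈-componentOf x = proj₂ (proj₂ (proj₂ components) x)

  module Restriction {n} (P : FinRel n) (po : IsPartialOrder _≡_ (_≤P_ P)) (S : Subset n)
    (closed : ∀ {x y} → _≤P_ P x y → (x ∈ S → y ∈ S) × (y ∈ S → x ∈ S))
    {L : Fin n → ℕ} (lab : IsLabeling n L) where

    open Promotion P po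
    open Standardization S L

    private
      Q = induced P S
      module Q = Promotion Q (induced-isPartialOrder P po S)
      m = ∣ S ∣
      e = emb S
      M = st L S

    private
      ⊏-restrict⁺ : ∀ {i j} → i Q.⊏ j → e i ⊏ e j
      ⊏-restrict⁺ (ei⊑ej , i≢j) = ei⊑ej , i≢j ∘ emb-injective S _ _

      ⊏-restrict⁻ : ∀ {i j} → e i ⊏ e j → i Q.⊏ j
      ⊏-restrict⁻ (ei⊑ej , ei≢ej) = ei⊑ej , λ { refl → ei≢ej refl }

      above : ∀ {i y} → e i ⊏ y → ∃ λ k → e k ≡ y
      above {i} (ei⊑y , _) = emb-surjective S _ (proj₁ (closed ei⊑y) (emb-∈ S i))

      below : ∀ {i y} → y ⊏ e i → ∃ λ k → e k ≡ y
      below {i} (y⊑ei , _) = emb-surjective S _ (proj₂ (closed y⊑ei) (emb-∈ S i))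

      label-pos-M = label-pos (st-isLabeling lab)
      label≤-M = label≤ (st-isLabeling lab)

    IsSuccessor-restrict⁺ : ∀ {i j} → Q.IsSuccessor M i j → IsSuccessor L (e i) (e j)
    IsSuccessor-restrict⁺ {i} {j} (i⊏j , j-min) = ⊏-restrict⁺ i⊏j , λ y ei⊏y → go (above ei⊏y) ei⊏y
      where
      go : ∀ {y} → (∃ λ k → e k ≡ y) → e i ⊏ y → L (e j) ≤ L y
      go (k , refl) ei⊏ek = st-cancel-≤ j k (j-min k (⊏-restrict⁻ ei⊏ek))

    IsSuccessor-restrict⁻ : ∀ {i j} → IsSuccessor L (e i) (e j) → Q.IsSuccessor M i j
    IsSuccessor-restrict⁻ (ei⊏ej , ej-min) =
      ⊏-restrict⁻ ei⊏ej , λ k i⊏k → st-mono-≤ _ k (ej-min (e k) (⊏-restrict⁺ i⊏k))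

    Maximal-restrict : ∀ {i} → Q.Maximal i → Maximal (e i)
    Maximal-restrict i-max y ei⊏y with above ei⊏y
    ... | k , refl = i-max k (⊏-restrict⁻ ei⊏y)

    OnChain-restrict⁻ : ∀ {x} → OnChain L x → ∀ i → e i ≡ x → Q.OnChain M i
    OnChain-restrict⁻ (start Lx≡1) i refl = Q.start (trans (st≡suc-count i) (cong suc (count-none _ none-smaller)))
      where
      none-smaller : ∀ j → ¬ L (e j) < L (e i)
      none-smaller j Lej<1 = <⇒≱ (subst (L (e j) <_) Lx≡1 Lej<1) (label-pos lab (e j))
    OnChain-restrict⁻ (next on-v v→x) i refl with below (proj₁ v→x)
    ... | k , refl = Q.next (OnChain-restrict⁻ on-v k refl) (IsSuccessor-restrict⁻ v→x)

    ∂-restrict-outside : ∀ {u} → L u ≡ 1 → u ∉ S → ∀ i → st (∂ P L) S i ≡ M i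
    ∂-restrict-outside {u} Lu≡1 u∉S = st-cong S (∂ P L) L
      (λ i j lt → ∸1-cancel-< (label-pos lab (e i)) (subst₂ _<_ (shifted i) (shifted j) lt))
      (λ i j lt → subst₂ _<_ (sym (shifted i)) (sym (shifted j)) (∸1-mono-< (label-pos lab (e i)) lt))
      where
      shifted : ∀ i → ∂ P L (e i) ≡ L (e i) ∸ 1
      shifted i = ∂-off lab λ on-ei → u∉S (proj₂ (closed (OnChain-above-start (label-injective lab) Lu≡1 on-ei)) (emb-∈ S i))

    module _ {u} (Lu≡1 : L u ≡ 1) (u∈S : u ∈ S) where

      private
        M≡1⇒L≡1 : ∀ i → M i ≡ 1 → L (e i) ≡ 1
        M≡1⇒L≡1 i Mi≡1 with L (e i) ℕ.≟ 1 | emb-surjective S u u∈S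
        ... | yes Lei≡1 | _ = Lei≡1
        ... | no Lei≢1 | k , refl = ⊥-elim (<⇒≱ (subst (M k <_) Mi≡1 (st-mono-< k i Lu<Lei)) (label-pos-M k))
          where
          Lu<Lei : L u < L (e i)
          Lu<Lei = subst (_< L (e i)) (sym Lu≡1) (≤∧≢⇒< (label-pos lab (e i)) (Lei≢1 ∘ sym))

      OnChain-restrict⁺ : ∀ {i} → Q.OnChain M i → OnChain L (e i)
      OnChain-restrict⁺ (Q.start Mi≡1) = start (M≡1⇒L≡1 _ Mi≡1)
      OnChain-restrict⁺ (Q.next on-i i→j) = next (OnChain-restrict⁺ on-i) (IsSuccessor-restrict⁺ i→j)

      private
        data Corresponding (i : Fin m) : Set where
          shifted : ∀ a → ∂ P L (e i) ≡ L (e a) ∸ 1 → ∂ Q M i ≡ M a ∸ 1 → Corresponding i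
          tops : ∂ P L (e i) ≡ n → ∂ Q M i ≡ m → Corresponding i

        correspond : ∀ i → Corresponding i
        correspond i with Q.∂-view (st-isLabeling lab) i
        ... | Q.off off-i eq = shifted i (∂-off lab λ on-ei → off-i (OnChain-restrict⁻ on-ei i refl)) eq
        ... | Q.on on-i i→j eq = shifted _ (∂-next lab (OnChain-restrict⁺ on-i) (IsSuccessor-restrict⁺ i→j)) eq
        ... | Q.top on-i i-max eq = tops (∂-top lab (OnChain-restrict⁺ on-i) (Maximal-restrict i-max)) eq

        order⁺ : ∀ i j → ∂ P L (e i) < ∂ P L (e j) → ∂ Q M i < ∂ Q M j
        order⁺ i j lt with correspond i | correspond j
        ... | shifted a ea fa | shifted b eb fb = subst₂ _<_ (sym fa) (sym fb) (∸1-mono-< (label-pos-M a)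
                (st-mono-< a b (∸1-cancel-< (label-pos lab (e a)) (subst₂ _<_ ea eb lt))))
        ... | shifted a _ fa | tops _ fb = subst₂ _<_ (sym fa) (sym fb) (∸1<bound (label-pos-M a) (label≤-M a))
        ... | tops ea _ | shifted b eb _ =
                ⊥-elim (<⇒≱ (subst₂ _<_ ea eb lt) (<⇒≤ (∸1<bound (label-pos lab (e b)) (label≤ lab (e b)))))
        ... | tops ea _ | tops eb _ = ⊥-elim (<-irrefl refl (subst₂ _<_ ea eb lt))

        order⁻ : ∀ i j → ∂ Q M i < ∂ Q M j → ∂ P L (e i) < ∂ P L (e j)
        order⁻ i j lt with correspond i | correspond j
        ... | shifted a ea fa | shifted b eb fb = subst₂ _<_ (sym ea) (sym eb) (∸1-mono-< (label-pos lab (e a))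
                (st-cancel-< a b (∸1-cancel-< (label-pos-M a) (subst₂ _<_ fa fb lt))))
        ... | shifted a ea _ | tops eb _ = subst₂ _<_ (sym ea) (sym eb) (∸1<bound (label-pos lab (e a)) (label≤ lab (e a)))
        ... | tops _ fa | shifted b _ fb = ⊥-elim (<⇒≱ (subst₂ _<_ fa fb lt) (<⇒≤ (∸1<bound (label-pos-M b) (label≤-M b))))
        ... | tops _ fa | tops _ fb = ⊥-elim (<-irrefl refl (subst₂ _<_ fa fb lt))

      ∂-restrict-inside : ∀ i → st (∂ P L) S i ≡ ∂ Q M i
      ∂-restrict-inside = st-unique S (∂ P L) (∂ Q M) (Q.∂-isLabeling (st-isLabeling lab)) order⁺ order⁻

  -- Tangled labelings of a disconnected poset

  TopTwoIn : ∀ {n} → Subset n → (Fin n → ℕ) → Set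
  TopTwoIn {n} S L = (∃ λ x → x ∈ S × L x ≡ n ∸ 1) × (∃ λ x → x ∈ S × L x ≡ n)

  topTwoIn? : ∀ {n} (S : Subset n) (L : Fin n → ℕ) → Dec (TopTwoIn S L)
  topTwoIn? {n} S L =
    Finₚ.any? (λ x → (x ∈? S) ×-dec (L x ℕ.≟ n ∸ 1)) ×-dec Finₚ.any? (λ x → (x ∈? S) ×-dec (L x ℕ.≟ n))

  IsLinExt-cong : ∀ {k} (R : FinRel k) {A B : Fin k → ℕ} → (∀ x → A x ≡ B x) → IsLinExt R A → IsLinExt R B
  IsLinExt-cong R A≗B linext x y x≤y = subst₂ _≤_ (A≗B x) (A≗B y) (linext x y x≤y)

  module Decomposition {n} (P : FinRel n) (po : IsPartialOrder _≡_ (_≤P_ P))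
    {r} {C : Fin r → Subset n} (components : AreComponents P r C) where

    open Promotion P po
    open Components P po

    private
      Q : (d : Fin r) → FinRel ∣ C d ∣
      Q d = induced P (C d)

      module Q (d : Fin r) = Promotion (Q d) (induced-isPartialOrder P po (C d))

    private
      ∂-unshift : ∀ {L} → IsLabeling n L → ∀ {ℓ x y a} → ∂ P L x ≡ ℓ → L y ≡ suc ℓ →
        ∂ P L x ≡ L a ∸ 1 → a ≡ y
      ∂-unshift {L} lab {ℓ} {x} {y} {a} eq Ly≡ ea = label-injective lab a y (begin
        L a            ≡⟨ suc-∸1 (label-pos lab a) ⟨
        suc (L a ∸ 1)  ≡⟨ cong suc (trans (sym ea) eq) ⟩
        suc ℓ          ≡⟨ Ly≡ ⟨
        L y            ∎)
        where open ≡-Reasoning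

    ∂-label-below : ∀ {L} → IsLabeling n L → ∀ {ℓ x y} → ∂ P L x ≡ ℓ → L y ≡ suc ℓ → ℓ < n → x ⊑ y
    ∂-label-below lab {x = x} eq Ly≡ ℓ<n with ∂-view lab x
    ... | off _ ex = subst (x ⊑_) (∂-unshift lab eq Ly≡ ex) ⊑-refl
    ... | on _ x→w ex = subst (x ⊑_) (∂-unshift lab eq Ly≡ ex) (proj₁ (proj₁ x→w))
    ... | top _ _ ex = contradiction (trans (sym ex) eq) (<⇒≢ ℓ<n ∘ sym)

    iter-∂-label-Connected : ∀ {L} → IsLabeling n L → ∀ k {ℓ x y} → ℓ + k ≤ n →
      iter k (∂ P) L x ≡ ℓ → L y ≡ ℓ + k → Connected P x y
    iter-∂-label-Connected lab zero {ℓ} {x} {y} _ Lx≡ Ly≡ =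
      subst (Connected P x) (label-injective lab x y (trans Lx≡ (trans (sym (+-identityʳ ℓ)) (sym Ly≡)))) ε
    iter-∂-label-Connected {L} lab (suc k) {ℓ} ℓ+1+k≤n Lkx≡ Ly≡ =
      ⊑⇒Connected (∂-label-below (iter-∂-isLabeling k lab) Lkx≡ (proj₂ z) ℓ<n)
      ◅◅ iter-∂-label-Connected lab k (subst (_≤ n) (+-suc ℓ k) ℓ+1+k≤n) (proj₂ z) (trans Ly≡ (+-suc ℓ k))
      where
      ℓ<n : ℓ < n
      ℓ<n = <-≤-trans (s≤s (m≤m+n ℓ k)) (subst (_≤ n) (+-suc ℓ k) ℓ+1+k≤n)
      z = element-labeled (iter-∂-isLabeling k lab) (suc ℓ) (s≤s z≤n) ℓ<n

    module _ {L} (lab : IsLabeling n L) (d : Fin r) where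

      private
        S = C d
        m = ∣ S ∣
        e = emb S
        M = st L S

      labelsUpTo : ℕ → ℕ
      labelsUpTo k = count m (λ j → L (e j) ≤? k)

      labelsUpTo-suc : ∀ k → labelsUpTo (suc k) ≡ labelsUpTo k + count m (λ j → L (e j) ℕ.≟ suc k)
      labelsUpTo-suc k = trans (count-split (λ j → L (e j) ≤? suc k) (λ j → L (e j) ≤? k)) (cong₂ _+_
        (count-cong _ (λ j → L (e j) ≤? k) (λ _ → proj₂) (λ _ p → m≤n⇒m≤1+n p , p))
        (count-cong _ (λ j → L (e j) ℕ.≟ suc k) (λ _ (p , q) → ≤-antisym p (≰⇒> q))
                                                (λ { _ eq → ≤-reflexive eq , λ p → 1+n≰n (subst (_≤ k) eq p) })))

      labelsUpTo-suc-∈ : ∀ {k y} → L y ≡ suc k → y ∈ S → labelsUpTo (suc k) ≡ suc (labelsUpTo k)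
      labelsUpTo-suc-∈ {k} {y} Ly≡ y∈S with emb-surjective S y y∈S
      ... | j , refl = trans (labelsUpTo-suc k) (trans
        (cong (labelsUpTo k +_) (count-unique _ j Ly≡ λ i eq →
          emb-injective S i j (label-injective lab _ _ (trans eq (sym Ly≡))))) (+-comm _ 1))

      labelsUpTo-suc-∉ : ∀ {k y} → L y ≡ suc k → y ∉ S → labelsUpTo (suc k) ≡ labelsUpTo k
      labelsUpTo-suc-∉ {k} {y} Ly≡ y∉S = trans (labelsUpTo-suc k) (trans
        (cong (labelsUpTo k +_) (count-none _ λ i eq →
          y∉S (subst (_∈ S) (label-injective lab _ _ (trans eq (sym Ly≡))) (emb-∈ S i))))
        (+-identityʳ _))

      labelsUpTo-zero : labelsUpTo 0 ≡ 0
      labelsUpTo-zero = count-none _ (λ j Lej≤0 → 1+n≰n (≤-trans (label-pos lab (e j)) Lej≤0))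

      labelsUpTo-n : labelsUpTo n ≡ m
      labelsUpTo-n = count-all _ (λ j → label≤ lab (e j))

      st-iter-∂ : ∀ k → k ≤ n → ∀ i → st (iter k (∂ P) L) S i ≡ iter (labelsUpTo k) (∂ (Q d)) M i
      st-iter-∂ zero _ i = cong (λ t → iter t (∂ (Q d)) M i) (sym labelsUpTo-zero)
      st-iter-∂ (suc k) k<n i = by-cases (y ∈? S)
        where
        open ≡-Reasoning
        open Restriction P po S (⊑-closed (proj₁ components d)) (iter-∂-isLabeling k lab)
        Lₖ = iter k (∂ P) L
        u = proj₁ (element-labeled (iter-∂-isLabeling k lab) 1 ≤-refl (≤-trans (s≤s z≤n) k<n))
        Lu≡1 = proj₂ (element-labeled (iter-∂-isLabeling k lab) 1 ≤-refl (≤-trans (s≤s z≤n) k<n))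
        y = proj₁ (element-labeled lab (suc k) (s≤s z≤n) k<n)
        Ly≡ = proj₂ (element-labeled lab (suc k) (s≤s z≤n) k<n)

        u~y : Connected P u y
        u~y = iter-∂-label-Connected lab k k<n Lu≡1 Ly≡

        by-cases : Dec (y ∈ S) → st (∂ P Lₖ) S i ≡ iter (labelsUpTo (suc k)) (∂ (Q d)) M i
        by-cases (yes y∈S) = begin
          st (∂ P Lₖ) S i                          ≡⟨ ∂-restrict-inside Lu≡1 u∈S i ⟩
          ∂ (Q d) (st Lₖ S) i                      ≡⟨ ∂-cong (Q d) (st-iter-∂ k (<⇒≤ k<n)) i ⟩
          iter (suc (labelsUpTo k)) (∂ (Q d)) M i  ≡⟨ cong (λ t → iter t (∂ (Q d)) M i) (labelsUpTo-suc-∈ Ly≡ y∈S) ⟨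
          iter (labelsUpTo (suc k)) (∂ (Q d)) M i  ∎
          where u∈S = Connected-closed (proj₁ components d) y∈S (Connected-sym u~y)
        by-cases (no y∉S) = begin
          st (∂ P Lₖ) S i                          ≡⟨ ∂-restrict-outside Lu≡1 u∉S i ⟩
          st Lₖ S i                                ≡⟨ st-iter-∂ k (<⇒≤ k<n) i ⟩
          iter (labelsUpTo k) (∂ (Q d)) M i        ≡⟨ cong (λ t → iter t (∂ (Q d)) M i) (labelsUpTo-suc-∉ Ly≡ y∉S) ⟨
          iter (labelsUpTo (suc k)) (∂ (Q d)) M i  ∎
          where u∉S = λ u∈S → y∉S (Connected-closed (proj₁ components d) u∈S u~y)

      labelsUpTo-suc≤ : ∀ k → labelsUpTo (suc k) ≤ suc (labelsUpTo k)
      labelsUpTo-suc≤ k with Finₚ.any? (λ j → L (e j) ℕ.≟ suc k)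
      ... | yes (j , Lej≡) = ≤-reflexive (labelsUpTo-suc-∈ Lej≡ (emb-∈ S j))
      ... | no none = ≤-trans (≤-reflexive (trans (labelsUpTo-suc k) (trans (cong (labelsUpTo k +_)
                        (count-none _ λ j eq → none (j , eq))) (+-identityʳ _)))) (n≤1+n _)

      module _ (2≤n : 2 ≤ n) where

        private
          t = n ∸ 2
          t+2≡n : suc (suc t) ≡ n
          t+2≡n = trans (+-comm 2 t) (m∸n+n≡m 2≤n)
          y₁ = element-labeled lab (suc t) (s≤s z≤n) (≤-trans (n≤1+n _) (≤-reflexive t+2≡n))
          y₂ = element-labeled lab (suc (suc t)) (s≤s z≤n) (≤-reflexive t+2≡n)

          same-label-∈ : ∀ {x y} → L x ≡ L y → x ∈ S → y ∈ S
          same-label-∈ Lx≡Ly x∈S = subst (_∈ S) (label-injective lab _ _ Lx≡Ly) x∈S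

          labelsUpTo-t+2 : labelsUpTo (suc (suc t)) ≡ m
          labelsUpTo-t+2 = subst (λ k → labelsUpTo k ≡ m) (sym t+2≡n) labelsUpTo-n

        labelsUpTo-top-two : TopTwoIn S L → 2 ≤ m × labelsUpTo t ≡ m ∸ 2
        labelsUpTo-top-two ((x₁ , x₁∈S , Lx₁≡) , (x₂ , x₂∈S , Lx₂≡)) =
          subst (2 ≤_) N≡m (s≤s (s≤s z≤n)) , cong (_∸ 2) N≡m
          where
          y₁∈S = same-label-∈ (trans Lx₁≡ (trans (cong (_∸ 1) (sym t+2≡n)) (sym (proj₂ y₁)))) x₁∈S
          y₂∈S = same-label-∈ (trans Lx₂≡ (trans (sym t+2≡n) (sym (proj₂ y₂)))) x₂∈S
          N≡m : suc (suc (labelsUpTo t)) ≡ m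
          N≡m = trans (sym (trans (labelsUpTo-suc-∈ (proj₂ y₂) y₂∈S) (cong suc (labelsUpTo-suc-∈ (proj₂ y₁) y₁∈S))))
                      labelsUpTo-t+2

        labelsUpTo-not-top-two : ¬ TopTwoIn S L → m ∸ 1 ≤ labelsUpTo t
        labelsUpTo-not-top-two not-top =
          ∸-monoˡ-≤ 1 (subst (_≤ suc (labelsUpTo t)) labelsUpTo-t+2 (cases (proj₁ y₁ ∈? S) (proj₁ y₂ ∈? S)))
          where
          cases : Dec (proj₁ y₁ ∈ S) → Dec (proj₁ y₂ ∈ S) → labelsUpTo (suc (suc t)) ≤ suc (labelsUpTo t)
          cases (yes y₁∈S) (yes y₂∈S) = contradiction
            ( (proj₁ y₁ , y₁∈S , trans (proj₂ y₁) (cong (_∸ 1) t+2≡n))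
            , (proj₁ y₂ , y₂∈S , trans (proj₂ y₂) t+2≡n)) not-top
          cases (no y₁∉S) _ = ≤-trans (labelsUpTo-suc≤ (suc t)) (s≤s (≤-reflexive (labelsUpTo-suc-∉ (proj₂ y₁) y₁∉S)))
          cases (yes _) (no y₂∉S) = ≤-trans (≤-reflexive (labelsUpTo-suc-∉ (proj₂ y₂) y₂∉S)) (labelsUpTo-suc≤ t)

        Tangled-top-two : TopTwoIn S L → Tangled (Q d) M ⇔ (¬ IsLinExt (Q d) (st (iter t (∂ P) L) S))
        Tangled-top-two top-two = mk⇔ (λ (_ , tangled) linext → tangled (IsLinExt-cong (Q d) st≗ linext))
                                  (λ ¬linext → 2≤m , λ linext → ¬linext (IsLinExt-cong (Q d) (sym ∘ st≗) linext))
          where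
          2≤m = proj₁ (labelsUpTo-top-two top-two)
          st≗ : ∀ i → st (iter t (∂ P) L) S i ≡ iter (m ∸ 2) (∂ (Q d)) M i
          st≗ i = trans (st-iter-∂ t (≤-trans (n≤1+n _) (≤-trans (n≤1+n _) (≤-reflexive t+2≡n))) i)
                        (cong (λ k → iter k (∂ (Q d)) M i) (proj₂ (labelsUpTo-top-two top-two)))

        IsLinExt-not-top-two : ¬ TopTwoIn S L → IsLinExt (Q d) (st (iter t (∂ P) L) S)
        IsLinExt-not-top-two not-top =
          IsLinExt-cong (Q d) (sym ∘ st-iter-∂ t (≤-trans (n≤1+n _) (≤-trans (n≤1+n _) (≤-reflexive t+2≡n))))
          (Q.iter-∂-IsLinExt d (labelsUpTo t) (Standardization.st-isLabeling S L lab)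
            (labelsUpTo-not-top-two not-top))

    IsLinExt-restrict : ∀ {A} → IsLinExt P A → ∀ d → IsLinExt (Q d) (st A (C d))
    IsLinExt-restrict {A} linext d i j ei⊑ej = Standardization.st-mono-≤ (C d) A i j (linext _ _ ei⊑ej)

    IsLinExt-glue : ∀ {A} → (∀ d → IsLinExt (Q d) (st A (C d))) → IsLinExt P A
    IsLinExt-glue {A} linext x y x⊑y = subst₂ (λ a b → A a ≤ A b) (proj₂ i) (proj₂ j)
      (Standardization.st-cancel-≤ (C d) A _ _ (linext d _ _ (subst₂ _⊑_ (sym (proj₂ i)) (sym (proj₂ j)) x⊑y)))
      where
      d = componentOf components x
      x∈ = ∈-componentOf components x
      i = emb-surjective (C d) x x∈
      j = emb-surjective (C d) y (proj₁ (⊑-closed (proj₁ components d) x⊑y) x∈)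

    Tangled⇔TopTwo : ∀ {L} → IsLabeling n L →
      Tangled P L ⇔ ∃ λ d → Tangled (Q d) (st L (C d)) × TopTwoIn (C d) L
    Tangled⇔TopTwo {L} lab = mk⇔ to from
      where
      to : Tangled P L → ∃ λ d → Tangled (Q d) (st L (C d)) × TopTwoIn (C d) L
      to (2≤n , ¬linext)
        with Finₚ.¬∀⟶∃¬ r _ (λ d → isLinExt? (Q d) (st (iter (n ∸ 2) (∂ P) L) (C d))) (¬linext ∘ IsLinExt-glue)
      ... | d , ¬linext-d with topTwoIn? (C d) L
      ...   | yes top-two = d , Equivalence.from (Tangled-top-two lab d 2≤n top-two) ¬linext-d , top-two
      ...   | no not-top-two = contradiction (IsLinExt-not-top-two lab d 2≤n not-top-two) ¬linext-d

      from : (∃ λ d → Tangled (Q d) (st L (C d)) × TopTwoIn (C d) L) → Tangled P L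
      from (d , tangled@(2≤m , _) , top-two) = 2≤n , λ linext →
        Equivalence.to (Tangled-top-two lab d 2≤n top-two) tangled (IsLinExt-restrict linext d)
        where 2≤n = ≤-trans 2≤m (∣p∣≤n (C d))

  sumₗ : ∀ {A : Set} → List A → (A → ℕ) → ℕ
  sumₗ [] f = 0
  sumₗ (x ∷ xs) f = f x + sumₗ xs f

  𝟙 : ∀ {P : Set} → Dec P → ℕ
  𝟙 (yes _) = 1
  𝟙 (no _) = 0

  𝟙-cong : ∀ {P Q : Set} (p : Dec P) (q : Dec Q) → (P → Q) → (Q → P) → 𝟙 p ≡ 𝟙 q
  𝟙-cong (yes _) (yes _) _ _ = refl
  𝟙-cong (yes p) (no ¬q) P⇒Q _ = contradiction (P⇒Q p) ¬q
  𝟙-cong (no ¬p) (yes q) _ Q⇒P = contradiction (Q⇒P q) ¬p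
  𝟙-cong (no _) (no _) _ _ = refl

  𝟙-× : ∀ {P Q : Set} (p : Dec P) (q : Dec Q) → 𝟙 (p ×-dec q) ≡ 𝟙 p * 𝟙 q
  𝟙-× (yes _) (yes _) = refl
  𝟙-× (yes _) (no _) = refl
  𝟙-× (no _) (yes _) = refl
  𝟙-× (no _) (no _) = refl

  𝟙-yes : ∀ {P : Set} (p : Dec P) → P → 𝟙 p ≡ 1
  𝟙-yes (yes _) _ = refl
  𝟙-yes (no ¬p) p = contradiction p ¬p

  𝟙-no : ∀ {P : Set} (p : Dec P) → ¬ P → 𝟙 p ≡ 0
  𝟙-no (yes p) ¬p = contradiction p ¬p
  𝟙-no (no _) _ = refl

  𝟙-⊎ : ∀ {P Q R : Set} (r : Dec R) (p : Dec P) (q : Dec Q) →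
    (R → P ⊎ Q) → (P → R) → (Q → R) → (P → Q → ⊥) → 𝟙 r ≡ 𝟙 p + 𝟙 q
  𝟙-⊎ (yes _) (yes p) (yes q) _ _ _ disjoint = ⊥-elim (disjoint p q)
  𝟙-⊎ (yes _) (yes _) (no _) _ _ _ _ = refl
  𝟙-⊎ (yes _) (no _) (yes _) _ _ _ _ = refl
  𝟙-⊎ (yes r) (no ¬p) (no ¬q) R⇒P⊎Q _ _ _ with R⇒P⊎Q r
  ... | inj₁ p = contradiction p ¬p
  ... | inj₂ q = contradiction q ¬q
  𝟙-⊎ (no ¬r) (yes p) _ _ P⇒R _ _ = contradiction (P⇒R p) ¬r
  𝟙-⊎ (no ¬r) (no _) (yes q) _ _ Q⇒R _ = contradiction (Q⇒R q) ¬r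
  𝟙-⊎ (no _) (no _) (no _) _ _ _ _ = refl

  module _ {A : Set} where

    length-filter : ∀ {P : A → Set} (P? : ∀ x → Dec (P x)) xs → length (filter P? xs) ≡ sumₗ xs (𝟙 ∘ P?)
    length-filter P? [] = refl
    length-filter P? (x ∷ xs) with P? x
    ... | yes _ = cong suc (length-filter P? xs)
    ... | no _ = length-filter P? xs

    sumₗ-cong-∈ : ∀ xs {f g : A → ℕ} → (∀ x → x ∈ₗ xs → f x ≡ g x) → sumₗ xs f ≡ sumₗ xs g
    sumₗ-cong-∈ [] f≗g = refl
    sumₗ-cong-∈ (x ∷ xs) f≗g = cong₂ _+_ (f≗g x (here refl)) (sumₗ-cong-∈ xs (λ y → f≗g y ∘ there))

    sumₗ-cong : ∀ xs {f g : A → ℕ} → (∀ x → f x ≡ g x) → sumₗ xs f ≡ sumₗ xs g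
    sumₗ-cong xs f≗g = sumₗ-cong-∈ xs (λ x _ → f≗g x)

    sumₗ-zero : ∀ xs (f : A → ℕ) → (∀ x → x ∈ₗ xs → f x ≡ 0) → sumₗ xs f ≡ 0
    sumₗ-zero [] f _ = refl
    sumₗ-zero (x ∷ xs) f f≡0 = cong₂ _+_ (f≡0 x (here refl)) (sumₗ-zero xs f (λ y → f≡0 y ∘ there))

    sumₗ-+ : ∀ xs (f g : A → ℕ) → sumₗ xs (λ x → f x + g x) ≡ sumₗ xs f + sumₗ xs g
    sumₗ-+ [] f g = refl
    sumₗ-+ (x ∷ xs) f g = begin
      f x + g x + sumₗ xs (λ x → f x + g x)  ≡⟨ cong (f x + g x +_) (sumₗ-+ xs f g) ⟩
      f x + g x + (sumₗ xs f + sumₗ xs g)    ≡⟨ +-assoc (f x) (g x) _ ⟩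
      f x + (g x + (sumₗ xs f + sumₗ xs g))  ≡⟨ cong (f x +_) (x+[y+z]≡y+[x+z] (g x) (sumₗ xs f) _) ⟩
      f x + (sumₗ xs f + (g x + sumₗ xs g))  ≡⟨ +-assoc (f x) (sumₗ xs f) _ ⟨
      f x + sumₗ xs f + (g x + sumₗ xs g)    ∎
      where open ≡-Reasoning

    sumₗ-*ˡ : ∀ xs c (f : A → ℕ) → sumₗ xs (λ x → c * f x) ≡ c * sumₗ xs f
    sumₗ-*ˡ [] c f = sym (*-zeroʳ c)
    sumₗ-*ˡ (x ∷ xs) c f = trans (cong (c * f x +_) (sumₗ-*ˡ xs c f)) (sym (*-distribˡ-+ c (f x) _))

    sumₗ-*ʳ : ∀ xs (f : A → ℕ) c → sumₗ xs (λ x → f x * c) ≡ sumₗ xs f * c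
    sumₗ-*ʳ xs f c = trans (sumₗ-cong xs (λ x → *-comm (f x) c)) (trans (sumₗ-*ˡ xs c f) (*-comm c _))

    sumₗ-++ : ∀ xs ys (f : A → ℕ) → sumₗ (xs ++ ys) f ≡ sumₗ xs f + sumₗ ys f
    sumₗ-++ [] ys f = refl
    sumₗ-++ (x ∷ xs) ys f = trans (cong (f x +_) (sumₗ-++ xs ys f)) (sym (+-assoc (f x) _ _))

    sumₗ-single : ∀ xs (f : A → ℕ) x₀ → AllPairs _≢_ xs → x₀ ∈ₗ xs →
      (∀ x → x ∈ₗ xs → x ≢ x₀ → f x ≡ 0) → sumₗ xs f ≡ f x₀
    sumₗ-single (x ∷ xs) f x₀ (x∉xs ∷ _) (here refl) others≡0 = trans
      (cong (f x +_) (sumₗ-zero xs f (λ y y∈ → others≡0 y (there y∈) (λ { refl → All.lookup x∉xs y∈ refl }))))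
      (+-identityʳ _)
    sumₗ-single (x ∷ xs) f x₀ (x∉xs ∷ distinct) (there x₀∈) others≡0 =
      trans (cong (_+ sumₗ xs f) (others≡0 x (here refl) (λ { refl → All.lookup x∉xs x₀∈ refl })))
            (sumₗ-single xs f x₀ distinct x₀∈ (λ y → others≡0 y ∘ there))

    sumₗ-filter : ∀ xs {P : A → Set} (P? : ∀ x → Dec (P x)) (f : A → ℕ) →
      sumₗ xs (λ x → 𝟙 (P? x) * f x) ≡ sumₗ (filter P? xs) f
    sumₗ-filter [] P? f = refl
    sumₗ-filter (x ∷ xs) P? f with P? x
    ... | yes _ = cong₂ _+_ (+-identityʳ (f x)) (sumₗ-filter xs P? f)
    ... | no _ = sumₗ-filter xs P? f

    sumₗ-𝟙+𝟙¬ : ∀ xs {P : A → Set} (P? : ∀ x → Dec (P x)) →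
      sumₗ xs (𝟙 ∘ P?) + sumₗ xs (𝟙 ∘ ¬? ∘ P?) ≡ length xs
    sumₗ-𝟙+𝟙¬ [] P? = refl
    sumₗ-𝟙+𝟙¬ (x ∷ xs) P? with P? x
    ... | yes _ = cong suc (sumₗ-𝟙+𝟙¬ xs P?)
    ... | no _ = trans (+-suc _ _) (cong suc (sumₗ-𝟙+𝟙¬ xs P?))

  module _ {A B : Set} where

    sumₗ-swap : ∀ (xs : List A) (ys : List B) (f : A → B → ℕ) →
      sumₗ xs (λ x → sumₗ ys (f x)) ≡ sumₗ ys (λ y → sumₗ xs (λ x → f x y))
    sumₗ-swap [] ys f = sym (sumₗ-zero ys _ (λ _ _ → refl))
    sumₗ-swap (x ∷ xs) ys f = trans (cong (sumₗ ys (f x) +_) (sumₗ-swap xs ys f))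
                                   (sym (sumₗ-+ ys (f x) (λ y → sumₗ xs (λ x → f x y))))

    sumₗ-map : ∀ (g : A → B) xs (f : B → ℕ) → sumₗ (map g xs) f ≡ sumₗ xs (f ∘ g)
    sumₗ-map g [] f = refl
    sumₗ-map g (x ∷ xs) f = cong (f (g x) +_) (sumₗ-map g xs f)

    sumₗ-concatMap : ∀ (g : A → List B) xs (f : B → ℕ) →
      sumₗ (concatMap g xs) f ≡ sumₗ xs (λ x → sumₗ (g x) f)
    sumₗ-concatMap g [] f = refl
    sumₗ-concatMap g (x ∷ xs) f =
      trans (sumₗ-++ (g x) (concatMap g xs) f) (cong (sumₗ (g x) f +_) (sumₗ-concatMap g xs f))

  sumFin : ∀ r → (Fin r → ℕ) → ℕ
  sumFin zero f = 0
  sumFin (suc r) f = f zero + sumFin r (f ∘ suc)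

  sumFin-cong : ∀ r {f g : Fin r → ℕ} → (∀ i → f i ≡ g i) → sumFin r f ≡ sumFin r g
  sumFin-cong zero f≗g = refl
  sumFin-cong (suc r) f≗g = cong₂ _+_ (f≗g zero) (sumFin-cong r (f≗g ∘ suc))

  sumFin-zero : ∀ r (f : Fin r → ℕ) → (∀ i → f i ≡ 0) → sumFin r f ≡ 0
  sumFin-zero zero f _ = refl
  sumFin-zero (suc r) f f≡0 = cong₂ _+_ (f≡0 zero) (sumFin-zero r (f ∘ suc) (f≡0 ∘ suc))

  sumₗ-sumFin : ∀ {A : Set} (xs : List A) r (g : A → Fin r → ℕ) →
    sumₗ xs (λ x → sumFin r (g x)) ≡ sumFin r (λ i → sumₗ xs (λ x → g x i))
  sumₗ-sumFin xs zero g = sumₗ-zero xs _ (λ _ _ → refl)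
  sumₗ-sumFin xs (suc r) g =
    trans (sumₗ-+ xs _ _) (cong (sumₗ xs (λ x → g x zero) +_) (sumₗ-sumFin xs r (λ x i → g x (suc i))))

  𝟙-any : ∀ r {T : Fin r → Set} (T? : ∀ i → Dec (T i)) → (∀ i j → T i → T j → i ≡ j) →
    𝟙 (Finₚ.any? T?) ≡ sumFin r (𝟙 ∘ T?)
  𝟙-any zero T? _ = refl
  𝟙-any (suc r) T? at-most-one = trans
    (𝟙-⊎ (Finₚ.any? T?) (T? zero) (Finₚ.any? (T? ∘ suc))
      (λ { (zero , t) → inj₁ t ; (suc i , t) → inj₂ (i , t) }) (zero ,_) (λ (i , t) → suc i , t)
      (λ t (i , t′) → case (at-most-one zero (suc i) t t′)))
    (cong (𝟙 (T? zero) +_) (𝟙-any r (T? ∘ suc) (λ i j tᵢ tⱼ → Finₚ.suc-injective (at-most-one (suc i) (suc j) tᵢ tⱼ))))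
    where
    case : ∀ {i : Fin r} → Fin.zero ≢ Fin.suc i
    case ()

  _≗?_ : ∀ {k} (f g : Fin k → ℕ) → Dec (∀ i → f i ≡ g i)
  f ≗? g = Finₚ.all? (λ i → f i ℕ.≟ g i)

  _≗ᵥ?_ : ∀ {k} (v : Vec ℕ k) (f : Fin k → ℕ) → Dec (∀ i → lookup v i ≡ f i)
  v ≗ᵥ? f = lookup v ≗? f

  module _ (Λ : List ℕ) where

    sumₗ-allVecs-suc : ∀ k (f : Vec ℕ (suc k) → ℕ) →
      sumₗ (allVecs Λ (suc k)) f ≡ sumₗ Λ (λ a → sumₗ (allVecs Λ k) (λ v → f (a ∷ v)))
    sumₗ-allVecs-suc k f = trans (sumₗ-concatMap (λ a → map (a ∷_) (allVecs Λ k)) Λ f)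
                                 (sumₗ-cong Λ (λ a → sumₗ-map (a ∷_) (allVecs Λ k) f))

    sumₗ-allVecs-cong : ∀ k {f g : Vec ℕ k → ℕ} → (∀ v → VAll.All (_∈ₗ Λ) v → f v ≡ g v) →
      sumₗ (allVecs Λ k) f ≡ sumₗ (allVecs Λ k) g
    sumₗ-allVecs-cong zero f≗g = cong (_+ 0) (f≗g [] VAll.[])
    sumₗ-allVecs-cong (suc k) {f} {g} f≗g = trans (sumₗ-allVecs-suc k f) (trans
      (sumₗ-cong-∈ Λ (λ a a∈ → sumₗ-allVecs-cong k (λ v v∈ → f≗g (a ∷ v) (a∈ VAll.∷ v∈))))
      (sym (sumₗ-allVecs-suc k g)))

    sumₗ-allVecs-≗ : AllPairs _≢_ Λ → ∀ k (f : Fin k → ℕ) → (∀ i → f i ∈ₗ Λ) → (h : Vec ℕ k → ℕ) →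
      sumₗ (allVecs Λ k) (λ v → 𝟙 (v ≗ᵥ? f) * h v) ≡ h (tabulate f)
    sumₗ-allVecs-≗ distinct zero f f∈ h =
      trans (cong (λ t → t * h [] + 0) (𝟙-yes ([] ≗ᵥ? f) λ ())) (trans (+-identityʳ _) (*-identityˡ _))
    sumₗ-allVecs-≗ distinct (suc k) f f∈ h = begin
      sumₗ (allVecs Λ (suc k)) (λ v → 𝟙 (v ≗ᵥ? f) * h v)
        ≡⟨ sumₗ-allVecs-suc k _ ⟩
      sumₗ Λ (λ a → sumₗ (allVecs Λ k) (λ v → 𝟙 ((a ∷ v) ≗ᵥ? f) * h (a ∷ v)))
        ≡⟨ sumₗ-cong Λ head ⟩
      sumₗ Λ (λ a → 𝟙 (a ℕ.≟ f zero) * h (a ∷ tabulate (f ∘ suc)))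
        ≡⟨ sumₗ-single Λ _ (f zero) distinct (f∈ zero)
             (λ a _ a≢ → cong (_* h (a ∷ tabulate (f ∘ suc))) (𝟙-no (a ℕ.≟ f zero) a≢)) ⟩
      𝟙 (f zero ℕ.≟ f zero) * h (tabulate f)
        ≡⟨ cong (_* h (tabulate f)) (𝟙-yes (f zero ℕ.≟ f zero) refl) ⟩
      1 * h (tabulate f)
        ≡⟨ *-identityˡ _ ⟩
      h (tabulate f) ∎
      where
      open ≡-Reasoning
      split : ∀ a v → 𝟙 ((a ∷ v) ≗ᵥ? f) ≡ 𝟙 (a ℕ.≟ f zero) * 𝟙 (v ≗ᵥ? (f ∘ suc))
      split a v = trans (𝟙-cong ((a ∷ v) ≗ᵥ? f) ((a ℕ.≟ f zero) ×-dec (v ≗ᵥ? (f ∘ suc)))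
                          (λ eq → eq zero , eq ∘ suc) (λ { (eq₀ , _) zero → eq₀ ; (_ , eqₛ) (suc i) → eqₛ i }))
                        (𝟙-× (a ℕ.≟ f zero) (v ≗ᵥ? (f ∘ suc)))
      head : ∀ a → sumₗ (allVecs Λ k) (λ v → 𝟙 ((a ∷ v) ≗ᵥ? f) * h (a ∷ v))
                 ≡ 𝟙 (a ℕ.≟ f zero) * h (a ∷ tabulate (f ∘ suc))
      head a = trans
        (sumₗ-cong (allVecs Λ k) (λ v → trans (cong (_* h (a ∷ v)) (split a v)) (*-assoc (𝟙 (a ℕ.≟ f zero)) _ _)))
        (trans (sumₗ-*ˡ (allVecs Λ k) (𝟙 (a ℕ.≟ f zero)) _)
               (cong (𝟙 (a ℕ.≟ f zero) *_) (sumₗ-allVecs-≗ distinct k (f ∘ suc) (f∈ ∘ suc) (h ∘ (a ∷_)))))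

  _without_ : List ℕ → ℕ → List ℕ
  Λ without a = filter (λ b → ¬? (a ℕ.≟ b)) Λ

  avoids? : ∀ {k} a (v : Vec ℕ k) → Dec (VAll.All (λ b → ¬ a ≡ b) v)
  avoids? a = VAll.all? (λ b → ¬? (a ℕ.≟ b))

  unique? : ∀ {k} (v : Vec ℕ k) → Dec (Unique v)
  unique? = VAllPairs.allPairs? (λ a b → ¬? (a ℕ.≟ b))

  𝟙-unique-∷ : ∀ {k} a (v : Vec ℕ k) → 𝟙 (unique? (a ∷ v)) ≡ 𝟙 (avoids? a v) * 𝟙 (unique? v)
  𝟙-unique-∷ a v = trans (𝟙-cong (unique? (a ∷ v)) (avoids? a v ×-dec unique? v)
                            (λ { (a∉ ∷ u) → a∉ , u }) (λ (a∉ , u) → a∉ ∷ u))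
                          (𝟙-× (avoids? a v) (unique? v))

  sumₗ-allVecs-avoids : ∀ Λ k a (h : Vec ℕ k → ℕ) →
    sumₗ (allVecs Λ k) (λ v → 𝟙 (avoids? a v) * h v) ≡ sumₗ (allVecs (Λ without a) k) h
  sumₗ-allVecs-avoids Λ zero a h = cong (_+ 0) (+-identityʳ (h []))
  sumₗ-allVecs-avoids Λ (suc k) a h = begin
    sumₗ (allVecs Λ (suc k)) (λ v → 𝟙 (avoids? a v) * h v)
      ≡⟨ sumₗ-allVecs-suc Λ k _ ⟩
    sumₗ Λ (λ b → sumₗ (allVecs Λ k) (λ v → 𝟙 (avoids? a (b ∷ v)) * h (b ∷ v)))
      ≡⟨ sumₗ-cong Λ head ⟩
    sumₗ Λ (λ b → 𝟙 (¬? (a ℕ.≟ b)) * sumₗ (allVecs (Λ without a) k) (h ∘ (b ∷_)))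
      ≡⟨ sumₗ-filter Λ (λ b → ¬? (a ℕ.≟ b)) _ ⟩
    sumₗ (Λ without a) (λ b → sumₗ (allVecs (Λ without a) k) (h ∘ (b ∷_)))
      ≡⟨ sumₗ-allVecs-suc (Λ without a) k h ⟨
    sumₗ (allVecs (Λ without a) (suc k)) h ∎
    where
    open ≡-Reasoning
    split : ∀ b v → 𝟙 (avoids? a (b ∷ v)) ≡ 𝟙 (¬? (a ℕ.≟ b)) * 𝟙 (avoids? a v)
    split b v = trans (𝟙-cong (avoids? a (b ∷ v)) (¬? (a ℕ.≟ b) ×-dec avoids? a v)
                         (λ { (a≢b VAll.∷ a∉) → a≢b , a∉ }) (λ (a≢b , a∉) → a≢b VAll.∷ a∉))
                      (𝟙-× (¬? (a ℕ.≟ b)) (avoids? a v))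
    head : ∀ b → sumₗ (allVecs Λ k) (λ v → 𝟙 (avoids? a (b ∷ v)) * h (b ∷ v))
               ≡ 𝟙 (¬? (a ℕ.≟ b)) * sumₗ (allVecs (Λ without a) k) (h ∘ (b ∷_))
    head b = trans
      (sumₗ-cong (allVecs Λ k) (λ v → trans (cong (_* h (b ∷ v)) (split b v)) (*-assoc (𝟙 (¬? (a ℕ.≟ b))) _ _)))
      (trans (sumₗ-*ˡ (allVecs Λ k) (𝟙 (¬? (a ℕ.≟ b))) (λ v → 𝟙 (avoids? a v) * h (b ∷ v)))
             (cong (𝟙 (¬? (a ℕ.≟ b)) *_) (sumₗ-allVecs-avoids Λ k a (h ∘ (b ∷_)))))

  sumₗ-allVecs-unique-∷ : ∀ Λ k a (G : Vec ℕ k → ℕ) →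
    sumₗ (allVecs Λ k) (λ v → 𝟙 (unique? (a ∷ v)) * G v) ≡ sumₗ (allVecs (Λ without a) k) (λ v → 𝟙 (unique? v) * G v)
  sumₗ-allVecs-unique-∷ Λ k a G = trans
    (sumₗ-cong (allVecs Λ k) (λ v → trans (cong (_* G v) (𝟙-unique-∷ a v)) (*-assoc (𝟙 (avoids? a v)) _ _)))
    (sumₗ-allVecs-avoids Λ k a (λ v → 𝟙 (unique? v) * G v))

  _↓_ : ℕ → ℕ → ℕ
  m ↓ zero = 1
  zero ↓ suc t = 0
  suc m ↓ suc t = suc m * (m ↓ t)

  ↓-zero : ∀ m t → m < t → m ↓ t ≡ 0
  ↓-zero zero (suc t) _ = refl
  ↓-zero (suc m) (suc t) (s≤s m<t) = trans (cong (suc m *_) (↓-zero m t m<t)) (*-zeroʳ (suc m))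

  ↓-suc : ∀ m t → m ↓ suc t ≡ m ↓ t * (m ∸ t)
  ↓-suc zero zero = refl
  ↓-suc zero (suc t) = refl
  ↓-suc (suc m) zero = *-comm (suc m) 1
  ↓-suc (suc m) (suc t) = trans (cong (suc m *_) (↓-suc m t)) (sym (*-assoc (suc m) (m ↓ t) (m ∸ t)))

  ↓-pascal : ∀ m t → suc m ↓ suc t ≡ m ↓ suc t + suc t * (m ↓ t)
  ↓-pascal m t with t ≤? m
  ... | yes t≤m = begin
    suc m * (m ↓ t)                      ≡⟨ *-comm (suc m) (m ↓ t) ⟩
    m ↓ t * suc m                        ≡⟨ cong (m ↓ t *_) (trans (+-suc (m ∸ t) t) (cong suc (m∸n+n≡m t≤m))) ⟨
    m ↓ t * (m ∸ t + suc t)              ≡⟨ *-distribˡ-+ (m ↓ t) (m ∸ t) (suc t) ⟩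
    m ↓ t * (m ∸ t) + m ↓ t * suc t      ≡⟨ cong₂ _+_ (↓-suc m t) (*-comm (suc t) (m ↓ t)) ⟨
    m ↓ suc t + suc t * (m ↓ t)          ∎
    where open ≡-Reasoning
  ... | no t≰m = begin
    suc m * (m ↓ t)                      ≡⟨ cong (suc m *_) m↓t≡0 ⟩
    suc m * 0                            ≡⟨ *-zeroʳ (suc m) ⟩
    0                                    ≡⟨ *-zeroʳ (suc t) ⟨
    suc t * 0
      ≡⟨ cong₂ _+_ (↓-zero m (suc t) (m≤n⇒m≤1+n (≰⇒> t≰m))) (cong (suc t *_) m↓t≡0) ⟨
    m ↓ suc t + suc t * (m ↓ t)          ∎
    where
    open ≡-Reasoning
    m↓t≡0 = ↓-zero m t (≰⇒> t≰m)

  ↓-nonZero : ∀ {m t} → t ≤ m → ℕ.NonZero (m ↓ t)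
  ↓-nonZero {t = zero} _ = _
  ↓-nonZero {suc m} {suc t} (s≤s t≤m) = m*n≢0 (suc m) (m ↓ t) {{_}} {{↓-nonZero t≤m}}

  !≡↓*! : ∀ {m t} → t ≤ m → m ! ≡ m ↓ t * (m ∸ t) !
  !≡↓*! {m} {zero} _ = sym (*-identityˡ (m !))
  !≡↓*! {suc m} {suc t} (s≤s t≤m) =
    trans (cong (suc m *_) (!≡↓*! t≤m)) (sym (*-assoc (suc m) (m ↓ t) ((m ∸ t) !)))

  ↓-!-step : ∀ m k t → m ≤ k → t ≤ suc k → (suc k ∸ t) * (m ↓ t * (k ∸ t) !) ≡ m ↓ t * (suc k ∸ t) !
  ↓-!-step m k t m≤k t≤1+k with t ≤? k
  ... | yes t≤k = begin
    (suc k ∸ t) * (m ↓ t * (k ∸ t) !)    ≡⟨ cong (_* (m ↓ t * (k ∸ t) !)) (+-∸-assoc 1 t≤k) ⟩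
    suc (k ∸ t) * (m ↓ t * (k ∸ t) !)    ≡⟨ x*[y*z]≡y*[x*z] (suc (k ∸ t)) (m ↓ t) ((k ∸ t) !) ⟩
    m ↓ t * (suc (k ∸ t) * (k ∸ t) !)    ≡⟨ cong (λ j → m ↓ t * j !) (+-∸-assoc 1 t≤k) ⟨
    m ↓ t * (suc k ∸ t) !                ∎
    where open ≡-Reasoning
  ... | no t≰k with ≤-antisym t≤1+k (≰⇒> t≰k)
  ...   | refl = begin
    (suc k ∸ suc k) * (m ↓ suc k * (k ∸ suc k) !)  ≡⟨ cong (_* (m ↓ suc k * (k ∸ suc k) !)) (n∸n≡0 (suc k)) ⟩
    0                                              ≡⟨ cong (_* (suc k ∸ suc k) !) (↓-zero m (suc k) (s≤s m≤k)) ⟨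
    m ↓ suc k * (suc k ∸ suc k) !                  ∎
    where open ≡-Reasoning

  ↓-!-pascal : ∀ m k t → t ≤ suc k →
    t * (m ↓ (t ∸ 1) * (k ∸ (t ∸ 1)) !) + m ↓ t * (suc k ∸ t) ! ≡ suc m ↓ t * (suc k ∸ t) !
  ↓-!-pascal m k zero _ = refl
  ↓-!-pascal m k (suc t) _ = begin
    suc t * (m ↓ t * F) + m ↓ suc t * F      ≡⟨ cong (_+ m ↓ suc t * F) (*-assoc (suc t) (m ↓ t) F) ⟨
    suc t * (m ↓ t) * F + m ↓ suc t * F      ≡⟨ *-distribʳ-+ F (suc t * (m ↓ t)) (m ↓ suc t) ⟨
    (suc t * (m ↓ t) + m ↓ suc t) * F        ≡⟨ cong (_* F) (trans (+-comm _ (m ↓ suc t)) (sym (↓-pascal m t))) ⟩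
    suc m ↓ suc t * F                        ∎
    where
    open ≡-Reasoning
    F = (k ∸ t) !

  -- Counting arrangements of distinct values

  valuesOn : ∀ {k} → Vec ℕ k → Subset k → List ℕ
  valuesOn [] [] = []
  valuesOn (a ∷ v) (inside ∷ S) = a ∷ valuesOn v S
  valuesOn (a ∷ v) (outside ∷ S) = valuesOn v S

  valuesOn-All : ∀ {k} {P : ℕ → Set} (v : Vec ℕ k) (S : Subset k) → VAll.All P v → All P (valuesOn v S)
  valuesOn-All [] [] VAll.[] = []
  valuesOn-All (a ∷ v) (inside ∷ S) (pa VAll.∷ pv) = pa ∷ valuesOn-All v S pv
  valuesOn-All (a ∷ v) (outside ∷ S) (_ VAll.∷ pv) = valuesOn-All v S pv

  _⊆ₗ?_ : (T X : List ℕ) → Dec (All (_∈ₗ X) T)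
  T ⊆ₗ? X = All.all? (_∈ₗ? X) T

  module _ (Λ : List ℕ) (Λ-distinct : AllPairs _≢_ Λ) where

    sumₗ-𝟙-≟ : ∀ a → a ∈ₗ Λ → sumₗ Λ (λ b → 𝟙 (a ℕ.≟ b)) ≡ 1
    sumₗ-𝟙-≟ a a∈ =
      trans (sumₗ-single Λ _ a Λ-distinct a∈ (λ b _ b≢a → 𝟙-no (a ℕ.≟ b) (b≢a ∘ sym))) (𝟙-yes (a ℕ.≟ a) refl)

    length-without : ∀ a → a ∈ₗ Λ → length (Λ without a) ≡ length Λ ∸ 1
    length-without a a∈ = begin
      length (Λ without a)        ≡⟨ length-filter _ Λ ⟩
      others                      ≡⟨ m+n∸m≡n 1 _ ⟨
      1 + others ∸ 1              ≡⟨ cong (λ s → s + others ∸ 1) (sumₗ-𝟙-≟ a a∈) ⟨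
      sumₗ Λ (λ b → 𝟙 (a ℕ.≟ b)) + others ∸ 1
                                  ≡⟨ cong (_∸ 1) (sumₗ-𝟙+𝟙¬ Λ (a ℕ.≟_)) ⟩
      length Λ ∸ 1                ∎
      where
      open ≡-Reasoning
      others = sumₗ Λ (λ b → 𝟙 (¬? (a ℕ.≟ b)))

    sumₗ-𝟙-∈ : ∀ T → AllPairs _≢_ T → All (_∈ₗ Λ) T → sumₗ Λ (λ a → 𝟙 (a ∈ₗ? T)) ≡ length T
    sumₗ-𝟙-∈ [] _ _ = sumₗ-zero Λ _ (λ _ _ → refl)
    sumₗ-𝟙-∈ (x ∷ T) (x∉T ∷ T-distinct) (x∈Λ ∷ T⊆Λ) = begin
      sumₗ Λ (λ a → 𝟙 (a ∈ₗ? x ∷ T))                          ≡⟨ sumₗ-cong Λ split ⟩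
      sumₗ Λ (λ a → 𝟙 (x ℕ.≟ a) + 𝟙 (a ∈ₗ? T))               ≡⟨ sumₗ-+ Λ _ _ ⟩
      sumₗ Λ (λ a → 𝟙 (x ℕ.≟ a)) + sumₗ Λ (λ a → 𝟙 (a ∈ₗ? T))
        ≡⟨ cong₂ _+_ (sumₗ-𝟙-≟ x x∈Λ) (sumₗ-𝟙-∈ T T-distinct T⊆Λ) ⟩
      suc (length T)                                          ∎
      where
      open ≡-Reasoning
      split : ∀ a → 𝟙 (a ∈ₗ? x ∷ T) ≡ 𝟙 (x ℕ.≟ a) + 𝟙 (a ∈ₗ? T)
      split a = 𝟙-⊎ (a ∈ₗ? x ∷ T) (x ℕ.≟ a) (a ∈ₗ? T)
                  (λ { (here a≡x) → inj₁ (sym a≡x) ; (there a∈T) → inj₂ a∈T })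
                  (λ x≡a → here (sym x≡a)) there (λ { refl a∈T → All.lookup x∉T a∈T refl })

  without-⊆ : ∀ {Λ T : List ℕ} a → All (_∈ₗ Λ) T → All (_∈ₗ Λ without a) (T without a)
  without-⊆ {Λ} {T} a T⊆Λ = All.tabulate λ y∈ → let (y∈T , a≢y) = ∈-filter⁻ (λ b → ¬? (a ℕ.≟ b)) {xs = T} y∈ in
    ∈-filter⁺ (λ b → ¬? (a ℕ.≟ b)) (All.lookup T⊆Λ y∈T) a≢y

  ⊆-without : ∀ {Λ T : List ℕ} a → All (_∈ₗ Λ) T → ¬ (a ∈ₗ T) → All (_∈ₗ Λ without a) T
  ⊆-without a T⊆Λ a∉T =
    All.tabulate λ y∈T → ∈-filter⁺ (λ b → ¬? (a ℕ.≟ b)) (All.lookup T⊆Λ y∈T) (λ { refl → a∉T y∈T })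

  without-∉ : ∀ (T : List ℕ) a → ¬ (a ∈ₗ T) → T without a ≡ T
  without-∉ T a a∉T = Listₚ.filter-all (λ b → ¬? (a ℕ.≟ b)) (All.tabulate λ y∈T → λ { refl → a∉T y∈T })

  ⊆-∷⇔⊆-without : ∀ (T X : List ℕ) a →
    (All (_∈ₗ a ∷ X) T → All (_∈ₗ X) (T without a)) × (All (_∈ₗ X) (T without a) → All (_∈ₗ a ∷ X) T)
  ⊆-∷⇔⊆-without T X a = to , from
    where
    to : All (_∈ₗ a ∷ X) T → All (_∈ₗ X) (T without a)
    to T⊆ = All.tabulate λ y∈ → let (y∈T , a≢y) = ∈-filter⁻ (λ b → ¬? (a ℕ.≟ b)) {xs = T} y∈ in
      case (All.lookup T⊆ y∈T) a≢y
      where case : ∀ {y} → y ∈ₗ a ∷ X → ¬ a ≡ y → y ∈ₗ X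
            case (here y≡a) a≢y = contradiction (sym y≡a) a≢y
            case (there y∈X) _ = y∈X
    from : All (_∈ₗ X) (T without a) → All (_∈ₗ a ∷ X) T
    from T⊆ = All.tabulate λ {y} y∈T → case y y∈T
      where case : ∀ y → y ∈ₗ T → y ∈ₗ a ∷ X
            case y y∈T with a ℕ.≟ y
            ... | yes refl = here refl
            ... | no a≢y = there (All.lookup T⊆ (∈-filter⁺ (λ b → ¬? (a ℕ.≟ b)) y∈T a≢y))

  countCovering : (Λ : List ℕ) (k : ℕ) → Subset k → List ℕ → ℕ
  countCovering Λ k S T = sumₗ (allVecs Λ k) (λ v → 𝟙 (unique? v) * 𝟙 (T ⊆ₗ? valuesOn v S))

  private
    module SplitOn (k : ℕ) (Λ T : List ℕ) (Λ-distinct : AllPairs _≢_ Λ) (|Λ|≡ : length Λ ≡ suc k)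
                   (T-distinct : AllPairs _≢_ T) (T⊆Λ : All (_∈ₗ Λ) T) where

      t = length T

      inT : sumₗ Λ (λ a → 𝟙 (a ∈ₗ? T)) ≡ t
      inT = sumₗ-𝟙-∈ Λ Λ-distinct T T-distinct T⊆Λ

      t+notInT : t + sumₗ Λ (λ a → 𝟙 (¬? (a ∈ₗ? T))) ≡ suc k
      t+notInT =
        trans (cong (_+ sumₗ Λ (λ a → 𝟙 (¬? (a ∈ₗ? T)))) (sym inT)) (trans (sumₗ-𝟙+𝟙¬ Λ (_∈ₗ? T)) |Λ|≡)

      notInT : sumₗ Λ (λ a → 𝟙 (¬? (a ∈ₗ? T))) ≡ suc k ∸ t
      notInT = trans (sym (m+n∸m≡n t _)) (cong (_∸ t) t+notInT)

      t≤1+k : t ≤ suc k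
      t≤1+k = subst (t ≤_) t+notInT (m≤m+n t _)

      length-without′ : ∀ a → a ∈ₗ Λ → length (Λ without a) ≡ k
      length-without′ a a∈ = trans (length-without Λ Λ-distinct a a∈) (cong (_∸ 1) |Λ|≡)

      without-distinct : ∀ a → AllPairs _≢_ (Λ without a)
      without-distinct a = AllPairsₚ.filter⁺ (λ b → ¬? (a ℕ.≟ b)) Λ-distinct

      sum-split : (g : ℕ → ℕ) (X Y : ℕ) →
        (∀ a → a ∈ₗ Λ → g a ≡ 𝟙 (a ∈ₗ? T) * X + 𝟙 (¬? (a ∈ₗ? T)) * Y) →
        sumₗ Λ g ≡ t * X + (suc k ∸ t) * Y
      sum-split g X Y g≡ = trans (sumₗ-cong-∈ Λ g≡) (trans (sumₗ-+ Λ _ _)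
        (cong₂ _+_ (trans (sumₗ-*ʳ Λ _ X) (cong (_* X) inT)) (trans (sumₗ-*ʳ Λ _ Y) (cong (_* Y) notInT))))

  -- Fill the first slot with each a ∈ Λ in turn; the value a can only be covered there
  -- when that slot lies in S.
  countCovering≡ : ∀ k (Λ : List ℕ) (S : Subset k) (T : List ℕ) → AllPairs _≢_ Λ → length Λ ≡ k →
    AllPairs _≢_ T → All (_∈ₗ Λ) T → countCovering Λ k S T ≡ ∣ S ∣ ↓ length T * (k ∸ length T) !
  countCovering≡ zero [] [] [] _ _ _ _ = refl
  countCovering≡ zero [] [] (_ ∷ _) _ _ _ (() ∷ _)
  countCovering≡ (suc k) Λ (inside ∷ S) T Λ-distinct |Λ|≡ T-distinct T⊆Λ = begin
    countCovering Λ (suc k) (inside ∷ S) T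
      ≡⟨ sumₗ-allVecs-suc Λ k _ ⟩
    sumₗ Λ (λ a → sumₗ (allVecs Λ k) (λ v → 𝟙 (unique? (a ∷ v)) * 𝟙 (T ⊆ₗ? (a ∷ valuesOn v S))))
      ≡⟨ sum-split _ X Y first ⟩
    t * X + (suc k ∸ t) * Y
      ≡⟨ cong (t * X +_) (↓-!-step m k t (∣p∣≤n S) t≤1+k) ⟩
    t * X + m ↓ t * (suc k ∸ t) !
      ≡⟨ ↓-!-pascal m k t t≤1+k ⟩
    suc m ↓ t * (suc k ∸ t) ! ∎
    where
    open ≡-Reasoning
    open SplitOn k Λ T Λ-distinct |Λ|≡ T-distinct T⊆Λ
    m = ∣ S ∣
    X = m ↓ (t ∸ 1) * (k ∸ (t ∸ 1)) !
    Y = m ↓ t * (k ∸ t) !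
    first : ∀ a → a ∈ₗ Λ → sumₗ (allVecs Λ k) (λ v → 𝟙 (unique? (a ∷ v)) * 𝟙 (T ⊆ₗ? (a ∷ valuesOn v S)))
                           ≡ 𝟙 (a ∈ₗ? T) * X + 𝟙 (¬? (a ∈ₗ? T)) * Y
    first a a∈Λ = begin
      sumₗ (allVecs Λ k) (λ v → 𝟙 (unique? (a ∷ v)) * 𝟙 (T ⊆ₗ? (a ∷ valuesOn v S)))
        ≡⟨ sumₗ-allVecs-unique-∷ Λ k a _ ⟩
      sumₗ (allVecs (Λ without a) k) (λ v → 𝟙 (unique? v) * 𝟙 (T ⊆ₗ? (a ∷ valuesOn v S)))
        ≡⟨ sumₗ-cong (allVecs (Λ without a) k) (λ v → cong (𝟙 (unique? v) *_)
             (𝟙-cong (T ⊆ₗ? (a ∷ valuesOn v S)) ((T without a) ⊆ₗ? valuesOn v S)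
                (proj₁ (⊆-∷⇔⊆-without T _ a)) (proj₂ (⊆-∷⇔⊆-without T _ a)))) ⟩
      countCovering (Λ without a) k S (T without a)
        ≡⟨ countCovering≡ k (Λ without a) S (T without a) (without-distinct a) (length-without′ a a∈Λ)
             (AllPairsₚ.filter⁺ (λ b → ¬? (a ℕ.≟ b)) T-distinct) (without-⊆ a T⊆Λ) ⟩
      m ↓ length (T without a) * (k ∸ length (T without a)) !
        ≡⟨ by-membership (a ∈ₗ? T) ⟩
      𝟙 (a ∈ₗ? T) * X + 𝟙 (¬? (a ∈ₗ? T)) * Y ∎
      where
      by-membership : (a∈? : Dec (a ∈ₗ T)) →
        m ↓ length (T without a) * (k ∸ length (T without a)) ! ≡ 𝟙 a∈? * X + 𝟙 (¬? a∈?) * Y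
      by-membership (yes a∈T) = trans (cong (λ j → m ↓ j * (k ∸ j) !) (length-without T T-distinct a a∈T))
                                      (sym (trans (+-identityʳ _) (+-identityʳ _)))
      by-membership (no a∉T) = trans (cong (λ T′ → m ↓ length T′ * (k ∸ length T′) !) (without-∉ T a a∉T))
                                     (sym (+-identityʳ _))
  countCovering≡ (suc k) Λ (outside ∷ S) T Λ-distinct |Λ|≡ T-distinct T⊆Λ = begin
    countCovering Λ (suc k) (outside ∷ S) T
      ≡⟨ sumₗ-allVecs-suc Λ k _ ⟩
    sumₗ Λ (λ a → sumₗ (allVecs Λ k) (λ v → 𝟙 (unique? (a ∷ v)) * 𝟙 (T ⊆ₗ? valuesOn v S)))
      ≡⟨ sum-split _ 0 Y first ⟩
    t * 0 + (suc k ∸ t) * Y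
      ≡⟨ cong (_+ (suc k ∸ t) * Y) (*-zeroʳ t) ⟩
    (suc k ∸ t) * Y
      ≡⟨ ↓-!-step m k t (∣p∣≤n S) t≤1+k ⟩
    m ↓ t * (suc k ∸ t) ! ∎
    where
    open ≡-Reasoning
    open SplitOn k Λ T Λ-distinct |Λ|≡ T-distinct T⊆Λ
    m = ∣ S ∣
    Y = m ↓ t * (k ∸ t) !
    first : ∀ a → a ∈ₗ Λ → sumₗ (allVecs Λ k) (λ v → 𝟙 (unique? (a ∷ v)) * 𝟙 (T ⊆ₗ? valuesOn v S))
                           ≡ 𝟙 (a ∈ₗ? T) * 0 + 𝟙 (¬? (a ∈ₗ? T)) * Y
    first a a∈Λ = trans (sumₗ-allVecs-unique-∷ Λ k a _) (by-membership (a ∈ₗ? T))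
      where
      by-membership : (a∈? : Dec (a ∈ₗ T)) →
        sumₗ (allVecs (Λ without a) k) (λ v → 𝟙 (unique? v) * 𝟙 (T ⊆ₗ? valuesOn v S))
          ≡ 𝟙 a∈? * 0 + 𝟙 (¬? a∈?) * Y
      by-membership (yes a∈T) = trans (sumₗ-allVecs-cong (Λ without a) k {g = λ _ → 0} λ v v⊆ →
          trans (cong (𝟙 (unique? v) *_) (𝟙-no (T ⊆ₗ? valuesOn v S) λ T⊆ →
                   proj₂ (∈-filter⁻ (λ b → ¬? (a ℕ.≟ b)) {xs = Λ}
                            (All.lookup (valuesOn-All v S v⊆) (All.lookup T⊆ a∈T))) refl))
                (*-zeroʳ (𝟙 (unique? v))))
        (sumₗ-zero (allVecs (Λ without a) k) _ (λ _ _ → refl))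
      by-membership (no a∉T) = trans (countCovering≡ k (Λ without a) S T (without-distinct a) (length-without′ a a∈Λ)
                                       T-distinct (⊆-without a T⊆Λ a∉T))
                                     (sym (+-identityʳ _))

  range1-distinct : ∀ k → AllPairs _≢_ (range1 k)
  range1-distinct k = Uniqueₚ.map⁺ suc-injective (Uniqueₚ.upTo⁺ k)

  length-range1 : ∀ k → length (range1 k) ≡ k
  length-range1 k = trans (Listₚ.length-map suc (upTo k)) (Listₚ.length-upTo k)

  ∈-range1⁺ : ∀ {k x} → 1 ≤ x → x ≤ k → x ∈ₗ range1 k
  ∈-range1⁺ {x = suc x} _ x<k = ∈-map⁺ suc (∈-upTo⁺ x<k)

  ∈-range1⁻ : ∀ {k x} → x ∈ₗ range1 k → 1 ≤ x × x ≤ k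
  ∈-range1⁻ x∈ with ∈-map⁻ suc x∈
  ... | y , y∈ , refl = s≤s z≤n , ∈-upTo⁻ y∈

  isLabeling⇔unique : ∀ {k} (v : Vec ℕ k) → VAll.All (_∈ₗ range1 k) v →
    (IsLabeling k (lookup v) → Unique v) × (Unique v → IsLabeling k (lookup v))
  isLabeling⇔unique v v⊆ =
      (λ lab → subst Unique (tabulate∘lookup v) (VUniqueₚ.tabulate⁺ (label-injective lab _ _)))
    , (λ unique → injective⇒labeling (lookup v) (λ i → ∈-range1⁻ (lookup⁺ v⊆ i)) (VUniqueₚ.lookup-injective unique))

  #Labelings : ∀ k {A : (Fin k → ℕ) → Set} → (∀ L → Dec (A L)) → ℕ
  #Labelings k A? = sumₗ (allVecs (range1 k) k) (λ v → 𝟙 (isLabeling? k (lookup v) ×-dec A? (lookup v)))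

  numTangled≡#Labelings : ∀ {n} (P : FinRel n) → numTangled P ≡ #Labelings n (tangled? P)
  numTangled≡#Labelings {n} P = length-filter _ (allVecs (range1 n) n)

  #Labelings-cong : ∀ k {A B : (Fin k → ℕ) → Set} (A? : ∀ L → Dec (A L)) (B? : ∀ L → Dec (B L)) →
    (∀ L → IsLabeling k L → A L → B L) → (∀ L → IsLabeling k L → B L → A L) → #Labelings k A? ≡ #Labelings k B?
  #Labelings-cong k A? B? A⇒B B⇒A = sumₗ-cong (allVecs (range1 k) k) λ v →
    𝟙-cong _ _ (λ (lab , a) → lab , A⇒B _ lab a) (λ (lab , b) → lab , B⇒A _ lab b)

  #Labelings≡#covering : ∀ k (S : Subset k) (T : List ℕ) {A : (Fin k → ℕ) → Set} (A? : ∀ L → Dec (A L)) →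
    (∀ v → A (lookup v) → All (_∈ₗ valuesOn v S) T) → (∀ v → All (_∈ₗ valuesOn v S) T → A (lookup v)) →
    #Labelings k A? ≡ countCovering (range1 k) k S T
  #Labelings≡#covering k S T A? A⇒ ⇒A = sumₗ-allVecs-cong (range1 k) k λ v v⊆ → trans
    (𝟙-× (isLabeling? k (lookup v)) (A? (lookup v)))
    (cong₂ _*_ (𝟙-cong (isLabeling? k (lookup v)) (unique? v)
                        (proj₁ (isLabeling⇔unique v v⊆)) (proj₂ (isLabeling⇔unique v v⊆)))
               (𝟙-cong (A? (lookup v)) (T ⊆ₗ? valuesOn v S) (A⇒ v) (⇒A v)))

  #Labelings-all : ∀ k → #Labelings k (λ _ → yes tt) ≡ k !
  #Labelings-all k = trans
    (#Labelings≡#covering k (Vec.replicate k inside) [] _ (λ _ _ → []) (λ _ _ → tt))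
    (trans (countCovering≡ k (range1 k) (Vec.replicate k inside) [] (range1-distinct k) (length-range1 k) [] []) (+-identityʳ (k !)))

  valuesOn⁺ : ∀ {k} (v : Vec ℕ k) (S : Subset k) {x} → x ∈ S → lookup v x ∈ₗ valuesOn v S
  valuesOn⁺ (a ∷ v) (inside ∷ S) Vec.here = here refl
  valuesOn⁺ (a ∷ v) (inside ∷ S) (Vec.there x∈) = there (valuesOn⁺ v S x∈)
  valuesOn⁺ (a ∷ v) (outside ∷ S) (Vec.there x∈) = valuesOn⁺ v S x∈

  valuesOn⁻ : ∀ {k} (v : Vec ℕ k) (S : Subset k) {y} → y ∈ₗ valuesOn v S → ∃ λ x → x ∈ S × lookup v x ≡ y
  valuesOn⁻ [] [] ()
  valuesOn⁻ (a ∷ v) (inside ∷ S) (here refl) = zero , Vec.here , refl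
  valuesOn⁻ (a ∷ v) (inside ∷ S) (there y∈) with valuesOn⁻ v S y∈
  ... | x , x∈ , eq = suc x , Vec.there x∈ , eq
  valuesOn⁻ (a ∷ v) (outside ∷ S) y∈ with valuesOn⁻ v S y∈
  ... | x , x∈ , eq = suc x , Vec.there x∈ , eq

  #Labelings-topTwo : ∀ n (S : Subset n) → 2 ≤ n → #Labelings n (topTwoIn? S) ≡ ∣ S ∣ ↓ 2 * (n ∸ 2) !
  #Labelings-topTwo n S 2≤n = trans
    (#Labelings≡#covering n S tops (topTwoIn? S)
      (λ v ((x , x∈ , vx≡) , (y , y∈ , vy≡)) →
         subst (_∈ₗ _) vx≡ (valuesOn⁺ v S x∈) ∷ subst (_∈ₗ _) vy≡ (valuesOn⁺ v S y∈) ∷ [])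
      (λ { v (p ∷ q ∷ []) → valuesOn⁻ v S p , valuesOn⁻ v S q }))
    (countCovering≡ n (range1 n) S tops (range1-distinct n) (length-range1 n) ((n∸1≢n ∷ []) ∷ [] ∷ []) tops⊆)
    where
    tops = n ∸ 1 ∷ n ∷ []
    n∸1≢n : n ∸ 1 ≢ n
    n∸1≢n eq = <-irrefl eq (∸1<bound (≤-trans (s≤s z≤n) 2≤n) ≤-refl)
    tops⊆ : All (_∈ₗ range1 n) tops
    tops⊆ = ∈-range1⁺ (∸-monoˡ-≤ 1 2≤n) (m∸n≤m n 1) ∷ ∈-range1⁺ (≤-trans (s≤s z≤n) 2≤n) ≤-refl ∷ []

  Extensional : ∀ {k} → ((Fin k → ℕ) → Set) → Set
  Extensional {k} A = ∀ L L′ → IsLabeling k L → (∀ x → L x ≡ L′ x) → A L → A L′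

  𝟙-labeling : ∀ k {A : (Fin k → ℕ) → Set} → (∀ L → Dec (A L)) → (Fin k → ℕ) → ℕ
  𝟙-labeling k A? L = 𝟙 (isLabeling? k L ×-dec A? L)

  𝟙-labeling-cong : ∀ k {A} (A? : ∀ L → Dec (A L)) → Extensional A →
    ∀ L L′ → (∀ x → L x ≡ L′ x) → 𝟙-labeling k A? L ≡ 𝟙-labeling k A? L′
  𝟙-labeling-cong k A? A-ext L L′ L≗L′ = 𝟙-cong _ _
    (λ (lab , a) → labeling-cong L≗L′ lab , A-ext L L′ lab L≗L′ a)
    (λ (lab , a) → labeling-cong (sym ∘ L≗L′) lab , A-ext L′ L lab (sym ∘ L≗L′) a)

  labeling-∘ : ∀ {k} {L : Fin k → ℕ} (ρ ρ′ : Fin k → Fin k) → (∀ x → ρ′ (ρ x) ≡ x) →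
    IsLabeling k L → IsLabeling k (L ∘ ρ)
  labeling-∘ {k} {L} ρ ρ′ ρ′∘ρ≗id lab = injective⇒labeling (L ∘ ρ) (λ x → label-pos lab (ρ x) , label≤ lab (ρ x))
    λ x y eq → trans (sym (ρ′∘ρ≗id x)) (trans (cong ρ′ (label-injective lab _ _ eq)) (ρ′∘ρ≗id y))

  sumₗ-allVecs-𝟙-≗ : ∀ k (f : Fin k → ℕ) → (∀ i → f i ∈ₗ range1 k) →
    sumₗ (allVecs (range1 k) k) (λ w → 𝟙 (w ≗ᵥ? f)) ≡ 1
  sumₗ-allVecs-𝟙-≗ k f f∈ = trans (sumₗ-cong (allVecs (range1 k) k) (λ w → sym (*-identityʳ _)))
    (sumₗ-allVecs-≗ (range1 k) (range1-distinct k) k f f∈ (λ _ → 1))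

  -- Reindex the sum over labelings by the bijection L ↦ L ∘ ρ of vectors.
  #Labelings-∘ : ∀ k (ρ ρ′ : Fin k → Fin k) → (∀ x → ρ (ρ′ x) ≡ x) → (∀ x → ρ′ (ρ x) ≡ x) →
    ∀ {A} (A? : ∀ L → Dec (A L)) → Extensional A → #Labelings k (λ L → A? (L ∘ ρ)) ≡ #Labelings k A?
  #Labelings-∘ k ρ ρ′ ρ∘ρ′≗id ρ′∘ρ≗id A? A-ext = begin
    sumₗ W (λ v → 𝟙 (isLabeling? k (lookup v) ×-dec A? (lookup v ∘ ρ)))
      ≡⟨ sumₗ-cong W (λ v → 𝟙-cong _ _ (λ (lab , a) → labeling-∘ ρ ρ′ ρ′∘ρ≗id lab , a)
                                        (λ (lab , a) → unpermute lab , a)) ⟩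
    sumₗ W (λ w → g (lookup w ∘ ρ))
      ≡⟨ sumₗ-allVecs-cong (range1 k) k (λ w w⊆ → sym (trans
           (sumₗ-allVecs-≗ (range1 k) (range1-distinct k) k (lookup w ∘ ρ) (λ i → lookup⁺ w⊆ (ρ i)) (g ∘ lookup))
           (𝟙-labeling-cong k A? A-ext _ _ (lookup∘tabulate (lookup w ∘ ρ))))) ⟩
    sumₗ W (λ w → sumₗ W (λ v → 𝟙 (v ≗ᵥ? (lookup w ∘ ρ)) * g (lookup v)))
      ≡⟨ sumₗ-swap W W _ ⟩
    sumₗ W (λ v → sumₗ W (λ w → 𝟙 (v ≗ᵥ? (lookup w ∘ ρ)) * g (lookup v)))
      ≡⟨ sumₗ-allVecs-cong (range1 k) k (λ v v⊆ → trans (sumₗ-*ʳ W (λ w → 𝟙 (v ≗ᵥ? (lookup w ∘ ρ))) (g (lookup v)))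
           (trans (cong (_* g (lookup v)) (exactly-one v v⊆)) (*-identityˡ _))) ⟩
    sumₗ W (λ v → g (lookup v)) ∎
    where
    open ≡-Reasoning
    W = allVecs (range1 k) k
    g = 𝟙-labeling k A?
    unpermute : ∀ {L} → IsLabeling k (L ∘ ρ) → IsLabeling k L
    unpermute {L} lab = labeling-cong (cong L ∘ ρ∘ρ′≗id) (labeling-∘ ρ′ ρ ρ∘ρ′≗id lab)
    transpose : ∀ v w → (∀ i → lookup v i ≡ lookup w (ρ i)) → ∀ j → lookup w j ≡ lookup v (ρ′ j)
    transpose v w v≗ j = trans (cong (lookup w) (sym (ρ∘ρ′≗id j))) (sym (v≗ (ρ′ j)))
    transpose⁻ : ∀ v w → (∀ j → lookup w j ≡ lookup v (ρ′ j)) → ∀ i → lookup v i ≡ lookup w (ρ i)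
    transpose⁻ v w w≗ i = trans (cong (lookup v) (sym (ρ′∘ρ≗id i))) (sym (w≗ (ρ i)))
    exactly-one : ∀ v → VAll.All (_∈ₗ range1 k) v → sumₗ W (λ w → 𝟙 (v ≗ᵥ? (lookup w ∘ ρ))) ≡ 1
    exactly-one v v⊆ = trans
      (sumₗ-cong W (λ w → 𝟙-cong (v ≗ᵥ? (lookup w ∘ ρ)) (w ≗ᵥ? (lookup v ∘ ρ′)) (transpose v w) (transpose⁻ v w)))
      (sumₗ-allVecs-𝟙-≗ k (lookup v ∘ ρ′) (λ i → lookup⁺ v⊆ (ρ′ i)))

  module Relabeling {m} {K₁ K₂ : Fin m → ℕ} (lab₁ : IsLabeling m K₁) (lab₂ : IsLabeling m K₂) where

    π π′ : Fin m → Fin m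
    π i = proj₁ (element-labeled lab₂ (K₁ i) (label-pos lab₁ i) (label≤ lab₁ i))
    π′ j = proj₁ (element-labeled lab₁ (K₂ j) (label-pos lab₂ j) (label≤ lab₂ j))

    K₂∘π≗K₁ : ∀ i → K₂ (π i) ≡ K₁ i
    K₂∘π≗K₁ i = proj₂ (element-labeled lab₂ (K₁ i) (label-pos lab₁ i) (label≤ lab₁ i))

    K₁∘π′≗K₂ : ∀ j → K₁ (π′ j) ≡ K₂ j
    K₁∘π′≗K₂ j = proj₂ (element-labeled lab₁ (K₂ j) (label-pos lab₂ j) (label≤ lab₂ j))

    π∘π′≗id : ∀ j → π (π′ j) ≡ j
    π∘π′≗id j = label-injective lab₂ _ _ (trans (K₂∘π≗K₁ (π′ j)) (K₁∘π′≗K₂ j))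

    π′∘π≗id : ∀ i → π′ (π i) ≡ i
    π′∘π≗id i = label-injective lab₁ _ _ (trans (K₁∘π′≗K₂ (π i)) (K₂∘π≗K₁ i))

  module ExtendAlong {n} (S : Subset n) {π π′ : Fin ∣ S ∣ → Fin ∣ S ∣}
    (π∘π′≗id : ∀ j → π (π′ j) ≡ j) (π′∘π≗id : ∀ i → π′ (π i) ≡ i) where

    private
      e = emb S

      index : ∀ x → x ∈ S → Fin ∣ S ∣
      index x x∈S = proj₁ (emb-surjective S x x∈S)

      index-emb : ∀ i x∈S → index (e i) x∈S ≡ i
      index-emb i x∈S = emb-injective S _ _ (proj₂ (emb-surjective S (e i) x∈S))

      extend : (Fin ∣ S ∣ → Fin ∣ S ∣) → Fin n → Fin n
      extend σ x with x ∈? S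
      ... | yes x∈S = e (σ (index x x∈S))
      ... | no _ = x

      extend-emb : ∀ σ i → extend σ (e i) ≡ e (σ i)
      extend-emb σ i with e i ∈? S
      ... | yes x∈S = cong (e ∘ σ) (index-emb i x∈S)
      ... | no x∉S = contradiction (emb-∈ S i) x∉S

      extend-inverse : ∀ {σ σ′} → (∀ j → σ (σ′ j) ≡ j) → ∀ x → extend σ (extend σ′ x) ≡ x
      extend-inverse {σ} {σ′} σ∘σ′≗id x with x ∈? S
      ... | yes x∈S = trans (extend-emb σ _) (trans (cong e (σ∘σ′≗id _)) (proj₂ (emb-surjective S x x∈S)))
      ... | no x∉S with x ∈? S
      ...   | yes x∈S = contradiction x∈S x∉S
      ...   | no _ = refl

      extend-∈ : ∀ σ {x} → x ∈ S → extend σ x ∈ S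
      extend-∈ σ {x} x∈S = subst (_∈ S) (sym (trans (cong (extend σ) (sym (proj₂ (emb-surjective S x x∈S))))
                                                    (extend-emb σ _))) (emb-∈ S _)

    ρ ρ′ : Fin n → Fin n
    ρ = extend π
    ρ′ = extend π′

    ρ-emb : ∀ i → ρ (e i) ≡ e (π i)
    ρ-emb = extend-emb π

    ρ∘ρ′≗id : ∀ x → ρ (ρ′ x) ≡ x
    ρ∘ρ′≗id = extend-inverse π∘π′≗id

    ρ′∘ρ≗id : ∀ x → ρ′ (ρ x) ≡ x
    ρ′∘ρ≗id = extend-inverse π′∘π≗id

    ρ-∈ : ∀ {x} → x ∈ S → ρ x ∈ S
    ρ-∈ = extend-∈ π

    ρ′-∈ : ∀ {x} → x ∈ S → ρ′ x ∈ S
    ρ′-∈ = extend-∈ π′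

  -- Fibres of standardization

  module Fibres {n} (S : Subset n) where

    private
      m = ∣ S ∣
      e = emb S
      W = allVecs (range1 m) m
      V = allVecs (range1 n) n

    fibre : (Fin m → ℕ) → ℕ
    fibre K = #Labelings n (λ L → (K ≗? st L S) ×-dec topTwoIn? S L)

    module _ {Φ : (Fin m → ℕ) → Set} (Φ? : ∀ K → Dec (Φ K)) (Φ-ext : Extensional Φ) where

      private
        top : Vec ℕ n → ℕ
        top v = 𝟙 (isLabeling? n (lookup v) ×-dec topTwoIn? S (lookup v))

        -- Each labeling lies in exactly one fibre, the one of its standardization.
        𝟙-by-fibres : ∀ v → 𝟙 (isLabeling? n (lookup v) ×-dec (Φ? (st (lookup v) S) ×-dec topTwoIn? S (lookup v)))
                          ≡ sumₗ W (λ K → 𝟙 (K ≗ᵥ? st (lookup v) S) * (𝟙-labeling m Φ? (lookup K) * top v))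
        𝟙-by-fibres v with isLabeling? n (lookup v)
        ... | no ¬lab = sym (sumₗ-zero W _ λ K _ → trans
          (cong (λ z → 𝟙 (K ≗ᵥ? st (lookup v) S) * (𝟙-labeling m Φ? (lookup K) * z))
                (𝟙-no (no ¬lab ×-dec topTwoIn? S (lookup v)) (¬lab ∘ proj₁)))
          (trans (cong (𝟙 (K ≗ᵥ? st (lookup v) S) *_) (*-zeroʳ (𝟙-labeling m Φ? (lookup K))))
                 (*-zeroʳ (𝟙 (K ≗ᵥ? st (lookup v) S)))))
        ... | yes lab = sym (begin
          sumₗ W (λ K → 𝟙 (K ≗ᵥ? M) * (𝟙-labeling m Φ? (lookup K) * t))
            ≡⟨ sumₗ-allVecs-≗ (range1 m) (range1-distinct m) m M M∈ (λ K → 𝟙-labeling m Φ? (lookup K) * t) ⟩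
          𝟙-labeling m Φ? (lookup (tabulate M)) * t
            ≡⟨ cong (_* t) (𝟙-labeling-cong m Φ? Φ-ext _ _ (lookup∘tabulate M)) ⟩
          𝟙-labeling m Φ? M * t
            ≡⟨ 𝟙-× (isLabeling? m M ×-dec Φ? M) (yes lab ×-dec topTwoIn? S (lookup v)) ⟨
          𝟙 ((isLabeling? m M ×-dec Φ? M) ×-dec (yes lab ×-dec topTwoIn? S (lookup v)))
            ≡⟨ 𝟙-cong _ (yes lab ×-dec (Φ? M ×-dec topTwoIn? S (lookup v)))
                 (λ ((_ , φ) , (l , t)) → l , φ , t) (λ (l , φ , t) → (Standardization.st-isLabeling S _ lab , φ) , (l , t)) ⟩
          𝟙 (yes lab ×-dec (Φ? M ×-dec topTwoIn? S (lookup v))) ∎)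
          where
          open ≡-Reasoning
          M = st (lookup v) S
          t = 𝟙 (yes lab ×-dec topTwoIn? S (lookup v))
          M∈ : ∀ i → M i ∈ₗ range1 m
          M∈ i = ∈-range1⁺ (label-pos (Standardization.st-isLabeling S _ lab) i) (label≤ (Standardization.st-isLabeling S _ lab) i)

        fibre-sum : ∀ K → sumₗ V (λ v → 𝟙 (K ≗ᵥ? st (lookup v) S) * (𝟙-labeling m Φ? (lookup K) * top v))
                        ≡ 𝟙-labeling m Φ? (lookup K) * fibre (lookup K)
        fibre-sum K = begin
          sumₗ V (λ v → 𝟙 (K ≗ᵥ? st (lookup v) S) * (φ * top v))
            ≡⟨ sumₗ-cong V (λ v → x*[y*z]≡y*[x*z] (𝟙 (K ≗ᵥ? st (lookup v) S)) φ (top v)) ⟩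
          sumₗ V (λ v → φ * (𝟙 (K ≗ᵥ? st (lookup v) S) * top v))  ≡⟨ sumₗ-*ˡ V φ _ ⟩
          φ * sumₗ V (λ v → 𝟙 (K ≗ᵥ? st (lookup v) S) * top v)    ≡⟨ cong (φ *_) (sumₗ-cong V in-fibre) ⟩
          φ * fibre (lookup K)                                    ∎
          where
          open ≡-Reasoning
          φ = 𝟙-labeling m Φ? (lookup K)
          in-fibre : ∀ v → 𝟙 (K ≗ᵥ? st (lookup v) S) * top v
                         ≡ 𝟙 (isLabeling? n (lookup v) ×-dec ((lookup K ≗? st (lookup v) S) ×-dec topTwoIn? S (lookup v)))
          in-fibre v = trans (sym (𝟙-× (K ≗ᵥ? st (lookup v) S) (isLabeling? n (lookup v) ×-dec topTwoIn? S (lookup v))))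
                             (𝟙-cong _ _ (λ (eq , l , t) → l , eq , t) (λ (l , eq , t) → eq , l , t))

      #Labelings-by-fibres : #Labelings n (λ L → Φ? (st L S) ×-dec topTwoIn? S L)
                           ≡ sumₗ W (λ K → 𝟙-labeling m Φ? (lookup K) * fibre (lookup K))
      #Labelings-by-fibres = trans (sumₗ-cong V 𝟙-by-fibres) (trans (sumₗ-swap V W _) (sumₗ-cong W fibre-sum))

    fibre-uniform : ∀ {K₁ K₂} → IsLabeling m K₁ → IsLabeling m K₂ → fibre K₁ ≡ fibre K₂
    fibre-uniform {K₁} {K₂} lab₁ lab₂ = trans (sym (#Labelings-∘ n ρ ρ′ ρ∘ρ′≗id ρ′∘ρ≗id A? A-ext))
      (#Labelings-cong n (A? ∘ (_∘ ρ)) (λ L → (K₂ ≗? st L S) ×-dec topTwoIn? S L) to from)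
      where
      open Relabeling lab₁ lab₂
      open ExtendAlong S {π} {π′} π∘π′≗id π′∘π≗id

      A? : ∀ L → Dec ((∀ i → K₁ i ≡ st L S i) × TopTwoIn S L)
      A? L = (K₁ ≗? st L S) ×-dec topTwoIn? S L

      A-ext : Extensional (λ L → (∀ i → K₁ i ≡ st L S i) × TopTwoIn S L)
      A-ext L L′ _ L≗L′ (K₁≗ , (x , x∈ , Lx≡) , (y , y∈ , Ly≡)) =
          (λ i → trans (K₁≗ i) (st-≗ S L≗L′ i))
        , (x , x∈ , trans (sym (L≗L′ x)) Lx≡)
        , (y , y∈ , trans (sym (L≗L′ y)) Ly≡)

      st-∘ρ : ∀ {L} → IsLabeling n L → ∀ i → st (L ∘ ρ) S i ≡ st L S (π i)
      st-∘ρ {L} lab =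
        st-unique S (L ∘ ρ) (st L S ∘ π) (labeling-∘ π π′ π′∘π≗id (Standardization.st-isLabeling S _ lab))
        (λ i j lt → Standardization.st-mono-< S L (π i) (π j) (subst₂ _<_ (cong L (ρ-emb i)) (cong L (ρ-emb j)) lt))
        (λ i j lt → subst₂ _<_ (sym (cong L (ρ-emb i))) (sym (cong L (ρ-emb j))) (Standardization.st-cancel-< S L (π i) (π j) lt))

      to : ∀ L → IsLabeling n L → (∀ i → K₁ i ≡ st (L ∘ ρ) S i) × TopTwoIn S (L ∘ ρ) →
        (∀ j → K₂ j ≡ st L S j) × TopTwoIn S L
      to L lab (K₁≗ , (x , x∈ , Lx≡) , (y , y∈ , Ly≡)) =
          (λ j → trans (sym (K₁∘π′≗K₂ j)) (trans (K₁≗ (π′ j)) (trans (st-∘ρ lab (π′ j)) (cong (st L S) (π∘π′≗id j)))))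
        , (ρ x , ρ-∈ x∈ , Lx≡) , (ρ y , ρ-∈ y∈ , Ly≡)

      from : ∀ L → IsLabeling n L → (∀ j → K₂ j ≡ st L S j) × TopTwoIn S L →
        (∀ i → K₁ i ≡ st (L ∘ ρ) S i) × TopTwoIn S (L ∘ ρ)
      from L lab (K₂≗ , (x , x∈ , Lx≡) , (y , y∈ , Ly≡)) =
        (λ i → trans (sym (K₂∘π≗K₁ i)) (trans (K₂≗ (π i)) (sym (st-∘ρ lab i))))
        , (ρ′ x , ρ′-∈ x∈ , trans (cong L (ρ∘ρ′≗id x)) Lx≡)
        , (ρ′ y , ρ′-∈ y∈ , trans (cong L (ρ∘ρ′≗id y)) Ly≡)

    private
      idLabel : Fin m → ℕ
      idLabel i = suc (toℕ i)

      idLabel-isLabeling : IsLabeling m idLabel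
      idLabel-isLabeling =
        injective⇒labeling idLabel (λ i → s≤s z≤n , toℕ<n i) (λ i j → Finₚ.toℕ-injective ∘ suc-injective)

    #Labelings-st-topTwo : ∀ {Φ} (Φ? : ∀ K → Dec (Φ K)) → Extensional Φ →
      #Labelings n (λ L → Φ? (st L S) ×-dec topTwoIn? S L) ≡ #Labelings m Φ? * fibre idLabel
    #Labelings-st-topTwo Φ? Φ-ext = trans (#Labelings-by-fibres Φ? Φ-ext) (trans
      (sumₗ-cong W uniform) (sumₗ-*ʳ W (𝟙-labeling m Φ? ∘ lookup) (fibre idLabel)))
      where
      uniform : ∀ K → 𝟙-labeling m Φ? (lookup K) * fibre (lookup K) ≡ 𝟙-labeling m Φ? (lookup K) * fibre idLabel
      uniform K with isLabeling? m (lookup K)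
      ... | yes lab = cong (𝟙 (yes lab ×-dec Φ? (lookup K)) *_) (fibre-uniform lab idLabel-isLabeling)
      ... | no _ = refl

    -- Taking Φ trivial pins down the common fibre size: m! · fibre = m (m - 1) (n - 2)!.
    #Labelings-st-topTwo-! : ∀ {Φ} (Φ? : ∀ K → Dec (Φ K)) → Extensional Φ → 2 ≤ m →
      #Labelings n (λ L → Φ? (st L S) ×-dec topTwoIn? S L) * (m ∸ 2) ! ≡ #Labelings m Φ? * (n ∸ 2) !
    #Labelings-st-topTwo-! Φ? Φ-ext 2≤m = begin
      #Labelings n (λ L → Φ? (st L S) ×-dec topTwoIn? S L) * (m ∸ 2) !
        ≡⟨ cong (_* (m ∸ 2) !) (#Labelings-st-topTwo Φ? Φ-ext) ⟩
      #Labelings m Φ? * F * (m ∸ 2) !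
        ≡⟨ *-assoc (#Labelings m Φ?) F ((m ∸ 2) !) ⟩
      #Labelings m Φ? * (F * (m ∸ 2) !)
        ≡⟨ cong (#Labelings m Φ? *_) (trans (*-comm F ((m ∸ 2) !)) F*[m∸2]!≡) ⟩
      #Labelings m Φ? * (n ∸ 2) ! ∎
      where
      open ≡-Reasoning
      F = fibre idLabel
      m!*F≡ : m ! * F ≡ m ↓ 2 * (n ∸ 2) !
      m!*F≡ = begin
        m ! * F
          ≡⟨ cong (_* F) (#Labelings-all m) ⟨
        #Labelings m (λ _ → yes tt) * F
          ≡⟨ #Labelings-st-topTwo (λ _ → yes tt) (λ _ _ _ _ _ → tt) ⟨
        #Labelings n (λ L → yes tt ×-dec topTwoIn? S L)
          ≡⟨ #Labelings-cong n (λ L → yes tt ×-dec topTwoIn? S L) (topTwoIn? S) (λ _ _ → proj₂) (λ _ _ top → tt , top) ⟩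
        #Labelings n (topTwoIn? S)
          ≡⟨ #Labelings-topTwo n S (≤-trans 2≤m (∣p∣≤n S)) ⟩
        m ↓ 2 * (n ∸ 2) ! ∎
      F*[m∸2]!≡ : (m ∸ 2) ! * F ≡ (n ∸ 2) !
      F*[m∸2]!≡ = *-cancelˡ-≡ ((m ∸ 2) ! * F) ((n ∸ 2) !) (m ↓ 2) {{↓-nonZero 2≤m}}
        (trans (sym (*-assoc (m ↓ 2) ((m ∸ 2) !) F)) (trans (cong (_* F) (sym (!≡↓*! 2≤m))) m!*F≡))

  private
    toℚᵘ-/suc : ∀ a d → toℚᵘ (ℤ.+ a ℚ./ suc d) ℚᵘ.≃ mkℚᵘ (ℤ.+ a) d
    toℚᵘ-/suc a d = ℚₚ.toℚᵘ-fromℚᵘ (mkℚᵘ (ℤ.+ a) d)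

  ℕ→ℚ-+ : ∀ a b → ℕ→ℚ (a + b) ≡ ℕ→ℚ a ℚ.+ ℕ→ℚ b
  ℕ→ℚ-+ a b = ℚₚ.toℚᵘ-injective (ℚᵘₚ.≃-trans (toℚᵘ-/suc (a + b) 0) (ℚᵘₚ.≃-sym
    (ℚᵘₚ.≃-trans (ℚₚ.toℚᵘ-homo-+ (ℕ→ℚ a) (ℕ→ℚ b))
    (ℚᵘₚ.≃-trans (ℚᵘₚ.+-cong (toℚᵘ-/suc a 0) (toℚᵘ-/suc b 0)) (*≡* eq)))))
    where
    eq : ((ℤ.+ a) ℤ.* (ℤ.+ 1) ℤ.+ (ℤ.+ b) ℤ.* (ℤ.+ 1)) ℤ.* (ℤ.+ 1) ≡ (ℤ.+ (a + b)) ℤ.* (ℤ.+ (1 * 1))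
    eq = trans (ℤₚ.*-identityʳ _) (trans (cong₂ ℤ._+_ (ℤₚ.*-identityʳ (ℤ.+ a)) (ℤₚ.*-identityʳ (ℤ.+ b)))
           (trans (sym (ℤₚ.pos-+ a b)) (sym (ℤₚ.*-identityʳ _))))

  ℕ→ℚ≡*/suc : ∀ c t D N → c * suc D ≡ t * N → ℕ→ℚ c ≡ ℕ→ℚ N ℚ.* (ℤ.+ t ℚ./ suc D)
  ℕ→ℚ≡*/suc c t D N c*D≡t*N = ℚₚ.toℚᵘ-injective (ℚᵘₚ.≃-trans (toℚᵘ-/suc c 0) (ℚᵘₚ.≃-sym
    (ℚᵘₚ.≃-trans (ℚₚ.toℚᵘ-homo-* (ℕ→ℚ N) (ℤ.+ t ℚ./ suc D))
    (ℚᵘₚ.≃-trans (ℚᵘₚ.*-cong (toℚᵘ-/suc N 0) (toℚᵘ-/suc t D)) (*≡* eq)))))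
    where
    eq : ((ℤ.+ N) ℤ.* (ℤ.+ t)) ℤ.* (ℤ.+ 1) ≡ (ℤ.+ c) ℤ.* (ℤ.+ (1 * suc D))
    eq = trans (ℤₚ.*-identityʳ _) (trans (sym (ℤₚ.pos-* N t)) (trans (cong ℤ.+_ (trans (*-comm N t) (sym c*D≡t*N)))
           (trans (ℤₚ.pos-* c (suc D)) (cong (λ z → (ℤ.+ c) ℤ.* (ℤ.+ z)) (sym (*-identityˡ (suc D)))))))

  ℕ→ℚ≡*/! : ∀ c t d N → c * d ! ≡ t * N → ℕ→ℚ c ≡ ℕ→ℚ N ℚ.* (t /! d)
  ℕ→ℚ≡*/! c t d N c*d!≡t*N with d ! | d !≢0
  ... | suc D | _ = ℕ→ℚ≡*/suc c t D N c*d!≡t*N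

  ℕ→ℚ-sumFin : ∀ r (c t d : Fin r → ℕ) N → (∀ i → c i * d i ! ≡ t i * N) →
    ℕ→ℚ (sumFin r c) ≡ ℕ→ℚ N ℚ.* ∑ r (λ i → t i /! d i)
  ℕ→ℚ-sumFin zero c t d N _ = sym (ℚₚ.*-zeroʳ (ℕ→ℚ N))
  ℕ→ℚ-sumFin (suc r) c t d N c*d!≡t*N = begin
    ℕ→ℚ (c zero + sumFin r (c ∘ suc))
      ≡⟨ ℕ→ℚ-+ (c zero) (sumFin r (c ∘ suc)) ⟩
    ℕ→ℚ (c zero) ℚ.+ ℕ→ℚ (sumFin r (c ∘ suc))
      ≡⟨ cong₂ ℚ._+_ (ℕ→ℚ≡*/! (c zero) (t zero) (d zero) N (c*d!≡t*N zero))
                     (ℕ→ℚ-sumFin r (c ∘ suc) (t ∘ suc) (d ∘ suc) N (c*d!≡t*N ∘ suc)) ⟩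
    ℕ→ℚ N ℚ.* (t zero /! d zero) ℚ.+ ℕ→ℚ N ℚ.* ∑ r (λ i → t (suc i) /! d (suc i))
      ≡⟨ ℚₚ.*-distribˡ-+ (ℕ→ℚ N) _ _ ⟨
    ℕ→ℚ N ℚ.* ∑ (suc r) (λ i → t i /! d i) ∎
    where open ≡-Reasoning

  #Labelings-none : ∀ k {A : (Fin k → ℕ) → Set} (A? : ∀ L → Dec (A L)) → (∀ L → ¬ A L) → #Labelings k A? ≡ 0
  #Labelings-none k A? none = sumₗ-zero (allVecs (range1 k) k) _ λ v _ →
    𝟙-no (isLabeling? k (lookup v) ×-dec A? (lookup v)) (none (lookup v) ∘ proj₂)

  Tangled-extensional : ∀ {k} (R : FinRel k) → Extensional (Tangled R)
  Tangled-extensional {k} R K K′ _ K≗K′ (2≤k , tangled) =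
    2≤k , tangled ∘ IsLinExt-cong R (sym ∘ iter-∂-cong R (k ∸ 2) K≗K′)

  module Counting {n} (P : FinRel n) (po : IsPartialOrder _≡_ (_≤P_ P))
    {r} {C : Fin r → Subset n} (components : AreComponents P r C) where

    private
      Q : (i : Fin r) → FinRel ∣ C i ∣
      Q i = induced P (C i)

    TangledIn? : ∀ i L → Dec (Tangled (Q i) (st L (C i)) × TopTwoIn (C i) L)
    TangledIn? i L = tangled? (Q i) (st L (C i)) ×-dec topTwoIn? (C i) L

    numTangled≡sumFin : numTangled P ≡ sumFin r (λ i → #Labelings n (TangledIn? i))
    numTangled≡sumFin = begin
      numTangled P
        ≡⟨ numTangled≡#Labelings P ⟩
      #Labelings n (tangled? P)
        ≡⟨ #Labelings-cong n (tangled? P) (λ L → Finₚ.any? (λ i → TangledIn? i L))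
             (λ L → Equivalence.to ∘ Decomposition.Tangled⇔TopTwo P po components)
             (λ L → Equivalence.from ∘ Decomposition.Tangled⇔TopTwo P po components) ⟩
      sumₗ V (λ v → 𝟙 (isLabeling? n (lookup v) ×-dec Finₚ.any? (λ i → TangledIn? i (lookup v))))
        ≡⟨ sumₗ-cong V (λ v → split (lookup v) (isLabeling? n (lookup v))) ⟩
      sumₗ V (λ v → sumFin r (λ i → 𝟙 (isLabeling? n (lookup v) ×-dec TangledIn? i (lookup v))))
        ≡⟨ sumₗ-sumFin V r _ ⟩
      sumFin r (λ i → #Labelings n (TangledIn? i)) ∎
      where
      open ≡-Reasoning
      V = allVecs (range1 n) n
      split : ∀ L (lab? : Dec (IsLabeling n L)) →
        𝟙 (lab? ×-dec Finₚ.any? (λ i → TangledIn? i L)) ≡ sumFin r (λ i → 𝟙 (lab? ×-dec TangledIn? i L))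
      split L (no ¬lab) = sym (sumFin-zero r _ λ i → 𝟙-no (no ¬lab ×-dec TangledIn? i L) (¬lab ∘ proj₁))
      split L (yes lab) = begin
        𝟙 (yes lab ×-dec Finₚ.any? (λ i → TangledIn? i L))
                                                            ≡⟨ 𝟙-cong _ (Finₚ.any? (λ i → TangledIn? i L)) proj₂ (lab ,_) ⟩
        𝟙 (Finₚ.any? (λ i → TangledIn? i L))                 ≡⟨ 𝟙-any r (λ i → TangledIn? i L) disjoint ⟩
        sumFin r (λ i → 𝟙 (TangledIn? i L))                 ≡⟨ sumFin-cong r (λ i → 𝟙-cong _ _ (lab ,_) proj₂) ⟩
        sumFin r (λ i → 𝟙 (yes lab ×-dec TangledIn? i L))   ∎
        where
        disjoint : ∀ i j → Tangled (Q i) (st L (C i)) × TopTwoIn (C i) L → Tangled (Q j) (st L (C j)) × TopTwoIn (C j) L → i ≡ j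
        disjoint i j (_ , _ , (x , x∈Ci , Lx≡n)) (_ , _ , (y , y∈Cj , Ly≡n)) =
          Components.component-unique P po components x∈Ci (subst (_∈ C j) (label-injective lab y x (trans Ly≡n (sym Lx≡n))) y∈Cj)

    #Labelings-TangledIn : ∀ i → #Labelings n (TangledIn? i) * (∣ C i ∣ ∸ 2) ! ≡ numTangled (Q i) * (n ∸ 2) !
    #Labelings-TangledIn i = by-size (2 ≤? ∣ C i ∣)
      where
      open ≡-Reasoning
      by-size : Dec (2 ≤ ∣ C i ∣) → #Labelings n (TangledIn? i) * (∣ C i ∣ ∸ 2) ! ≡ numTangled (Q i) * (n ∸ 2) !
      by-size (yes 2≤m) = trans (Fibres.#Labelings-st-topTwo-! (C i) (tangled? (Q i)) (Tangled-extensional (Q i)) 2≤m)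
                                (cong (_* (n ∸ 2) !) (sym (numTangled≡#Labelings (Q i))))
      by-size (no 2≰m) = begin
        #Labelings n (TangledIn? i) * (∣ C i ∣ ∸ 2) !
          ≡⟨ cong (_* (∣ C i ∣ ∸ 2) !) (#Labelings-none n (TangledIn? i) (λ _ ((2≤m , _) , _) → 2≰m 2≤m)) ⟩
        0
          ≡⟨ cong (_* (n ∸ 2) !) (trans (numTangled≡#Labelings (Q i))
                                        (#Labelings-none _ (tangled? (Q i)) (λ _ (2≤m , _) → 2≰m 2≤m))) ⟨
        numTangled (Q i) * (n ∸ 2) ! ∎

open ExtendedPromotion using (module Decomposition; module Counting; ℕ→ℚ-sumFin)
open import Data.Rational using (_*_)

theorem3p4 : (n : ℕ) (P : FinRel n) → IsPartialOrder _≡_ (_≤P_ P)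
    → (r : ℕ) (C : Fin r → Subset n) → AreComponents P r C
    → ((L : Fin n → ℕ) → IsLabeling n L →
        (Tangled P L ⇔
          ∃ λ i → Tangled (induced P (C i)) (st L (C i))
                × (∃ λ x → x ∈ C i × L x ≡ n ∸ 1)
                × (∃ λ x → x ∈ C i × L x ≡ n)))
      × (2 ≤ n →
          ℕ→ℚ (numTangled P)
            ≡ ℕ→ℚ ((n ∸ 2) !)
              * ∑ r (λ i → numTangled (induced P (C i)) /! (∣ C i ∣ ∸ 2)))
-- The formula also holds for n < 2, where both sides vanish.
theorem3p4 n P po r C components =
    (λ L → Decomposition.Tangled⇔TopTwo P po components)
  , λ _ → trans (cong ℕ→ℚ numTangled≡sumFin)
                (ℕ→ℚ-sumFin r _ (numTangled ∘ Q) (λ i → ∣ C i ∣ ∸ 2) ((n ∸ 2) !) #Labelings-TangledIn)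
  where
  open Counting P po components
  Q : (i : Fin r) → FinRel ∣ C i ∣
  Q i = induced P (C i)
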